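{- For all positive integers $n\ge 1$, \[ |g^{ -1}(n)|=\sum_{d\mid n}\mu^2\!\left(\frac{n}{d}\right)C_{\Omega}(d), \] where $g^{ -1}$ is the Dirichlet inverse of $g(n)=\omega(n)+1$.
   Context: $\mu$ is the Möbius function, $\omega(n)$ the number of distinct prime divisors of $n$ ($\omega(1)=0$), $\Omega(n)$ the number of prime divisors counted with multiplicity. $C_{\Omega}(1)=1$ and, for $n\ge2$, $C_{\Omega}(n)=\Omega(n)!\prod_{p^{\alpha}\| n}\frac{1}{\alpha!}$, the product over prime powers exactly dividing $n$. The Dirichlet inverse $g^{ -1}$ satisfies $\sum_{d\mid n}g(d)g^{ -1}(n/d)=1$ if $n=1$ and $0$ otherwise. -}

module Defs where

open import Data.Nat as ℕ using (ℕ; zero; suc; _≤_; NonZero; _^_; _!)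
open import Data.Nat.Properties using (m*n≢0; _!≢0)
open import Data.Nat.Divisibility using (_∣_; _∣?_)
open import Data.Nat.Primality using (Prime; prime?)
open import Data.Nat.DivMod using (_/_)
open import Data.Nat.ListAction using (sum)
open import Data.Integer as ℤ using (ℤ)
open import Data.List using (List; []; _∷_; map; filter; length; upTo; foldr; null)
open import Data.Bool using (if_then_else_)
open import Relation.Nullary.Decidable using (_×-dec_; ⌊_⌋)
open import Relation.Binary.PropositionalEquality using (_≡_)

range1 : ℕ → List ℕ
range1 n = map suc (upTo n)

divisors : ℕ → List ℕ
divisors n = filter (_∣? n) (range1 n)

primeDivisors : ℕ → List ℕ
primeDivisors n = filter (λ p → prime? p ×-dec (p ∣? n)) (range1 n)

ω : ℕ → ℕ
ω n = length (primeDivisors n)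

-- α = v_p(n): the exponent with p^α ∥ n (for prime p and n ≥ 1),
-- i.e. the number of k ∈ {1..n} with p^k ∣ n
mult : ℕ → ℕ → ℕ
mult p n = length (filter (λ k → (p ^ k) ∣? n) (range1 n))

Ω : ℕ → ℕ
Ω n = sum (map (λ p → mult p n) (primeDivisors n))

prodFact : List ℕ → ℕ
prodFact [] = 1
prodFact (a ∷ as) = (a !) ℕ.* prodFact as

prodFact≢0 : ∀ as → NonZero (prodFact as)
prodFact≢0 [] = _
prodFact≢0 (a ∷ as) = m*n≢0 (a !) (prodFact as) {{a !≢0}} {{prodFact≢0 as}}

CΩ : ℕ → ℕ
CΩ n = ((Ω n !) / prodFact αs) {{prodFact≢0 αs}}
  where αs = map (λ p → mult p n) (primeDivisors n)

μ : ℕ → ℤ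
μ n = if null (filter (λ p → prime? p ×-dec ((p ℕ.* p) ∣? n)) (range1 n))
      then (ℤ.- ℤ.1ℤ) ℤ.^ ω n
      else ℤ.0ℤ

sumℤ : List ℤ → ℤ
sumℤ = foldr ℤ._+_ ℤ.0ℤ

dirichlet : (ℕ → ℤ) → (ℕ → ℤ) → ℕ → ℤ
dirichlet f h n = sumℤ (map (λ i → f (suc i) ℤ.* h (n / suc i))
                             (filter (λ i → suc i ∣? n) (upTo n)))

δ₁ : ℕ → ℤ
δ₁ 1 = ℤ.1ℤ
δ₁ _ = ℤ.0ℤ

IsDirichletInverse : (ℕ → ℤ) → (ℕ → ℤ) → Set
IsDirichletInverse f hinv = ∀ n → 1 ≤ n → dirichlet f hinv n ≡ δ₁ n

g : ℕ → ℤ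
g n = ℤ.+ (ω n ℕ.+ 1)

{-# OPTIONS --safe #-}
-- Since ω(n) + 1 counts the divisor 1 and the prime divisors of n, g = 𝟙 ⋆ (δ₁ + 𝟙ℙ). The
-- multinomial recurrence CΩ(n) = Σ_{p ∣ n} CΩ(n/p), together with λ(n/p) = -λ(n) for the Liouville
-- function λ(n) = (-1)^Ω(n), says that (δ₁ + 𝟙ℙ) ⋆ λCΩ = δ₁; with μ ⋆ 𝟙 = δ₁ this gives
-- g⁻¹ = μ ⋆ λCΩ. Writing μ = λ μ² and using that λ is completely multiplicative,
-- g⁻¹(n) = λ(n) Σ_{d ∣ n} μ²(d) CΩ(n/d): a sign times a sum of nonnegative terms.
module Submission where

open import Defs
open import Level using (Level)
open import Algebra.Bundles using (CommutativeSemigroup)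
open import Algebra.Structures using (IsCommutativeMonoid)
open import Data.Nat as ℕ using (ℕ; zero; suc; _≤_; _<_; z≤n; s≤s; _∸_; _≟_; _^_; _!; >-nonZero)
open import Data.Nat.Properties as ℕₚ
  using (≤-refl; ≤-trans; <-≤-trans; m≤n⇒m≤1+n; ≤∧≢⇒<; ≤-pred; <⇒≢)
open import Data.Nat.Divisibility as ℕᵈ using (_∣_; _∤_; _∣?_; divides)
open import Data.Nat.DivMod using (_/_; m*n/n≡m; n/1≡n)
open import Data.Nat.Coprimality using (Coprime; coprime-divisor)
open import Data.Nat.Primality
  using (Prime; prime?; euclidsLemma; prime⇒nonZero; prime⇒nonTrivial; prime⇒irreducible; ¬prime[1])
open import Data.Nat.Primality.Factorisation using (factorise; PrimeFactorisation)
open import Data.Nat.ListAction using (sum; product)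
open import Data.Nat.Induction using (<-wellFounded)
open import Data.Integer as ℤ using (ℤ; +_; 0ℤ; 1ℤ; -_; _+_; _*_; ∣_∣)
import Data.Integer.Properties as ℤₚ
open import Data.Integer.Tactic.RingSolver using (solve-∀)
import Algebra.Properties.CommutativeSemigroup ℕₚ.*-commutativeSemigroup as ℕ*-Props
import Algebra.Properties.CommutativeSemigroup ℤₚ.*-commutativeSemigroup as ℤ*-Props
open import Data.Bool using (if_then_else_)
open import Data.List using (List; []; _∷_; _++_; map; filter; foldr; upTo; null; length)
open import Data.List.Properties using (map-++; map-∘; upTo-∷ʳ; filter-none; filter-some)
import Data.List.Relation.Unary.All as All
open import Data.List.Relation.Unary.Any using (any?)
open import Data.List.Membership.Propositional using (_∈_; find; lose)
open import Data.List.Membership.Propositional.Properties using (∈-map⁺; ∈-upTo⁺)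
open import Data.Product using (∃; _×_; _,_)
open import Data.Sum using (_⊎_; inj₁; inj₂)
open import Data.Empty using (⊥-elim)
open import Function using (_∘_)
open import Induction.WellFounded using (Acc; acc)
open import Relation.Binary.PropositionalEquality
open import Relation.Nullary using (Dec; yes; no; ¬_; contradiction)
open import Relation.Nullary.Decidable using (_×-dec_; ¬?)
open import Relation.Unary using (Decidable)

private
  variable
    a p q : Level
    A : Set a
    P : Set p
    Q : Set q

-- Conditionals and sums over [1, n]

infix 5 _if_else_
_if_else_ : A → Dec P → A → A
x if yes _ else y = x
x if no _ else y = y

if-yes : (P? : Dec P) {x y : A} → P → (x if P? else y) ≡ x
if-yes (yes _) _ = refl
if-yes (no ¬p) p = ⊥-elim (¬p p)

if-no : (P? : Dec P) {x y : A} → ¬ P → (x if P? else y) ≡ y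
if-no (yes p) ¬p = ⊥-elim (¬p p)
if-no (no _) _ = refl

if-same : (P? : Dec P) {x : A} → (x if P? else x) ≡ x
if-same (yes _) = refl
if-same (no _) = refl

if-map : ∀ {b} {B : Set b} (f : A → B) (P? : Dec P) {x y : A} → f (x if P? else y) ≡ (f x if P? else f y)
if-map f (yes _) = refl
if-map f (no _) = refl

if-⇔ : (P? : Dec P) (Q? : Dec Q) {x x′ y : A} → (P → Q) → (Q → P) → x ≡ x′ →
       (x if P? else y) ≡ (x′ if Q? else y)
if-⇔ (yes _) (yes _) _ _ x≡x′ = x≡x′
if-⇔ (yes p) (no ¬q) P⇒Q _ _ = ⊥-elim (¬q (P⇒Q p))
if-⇔ (no ¬p) (yes q) _ Q⇒P _ = ⊥-elim (¬p (Q⇒P q))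
if-⇔ (no _) (no _) _ _ _ = refl

if-×-dec : (P? : Dec P) (Q? : Dec Q) {x y : A} →
           (x if P? ×-dec Q? else y) ≡ ((x if Q? else y) if P? else y)
if-×-dec (yes _) (yes _) = refl
if-×-dec (yes _) (no _) = refl
if-×-dec (no _) _ = refl

module RangeSum {A : Set} {_∙_ : A → A → A} {ε : A}
                (isCM : IsCommutativeMonoid _≡_ _∙_ ε) where

  open IsCommutativeMonoid isCM using (assoc; identityˡ; identityʳ; isCommutativeSemigroup)

  private
    commutativeSemigroup : CommutativeSemigroup _ _
    commutativeSemigroup = record { isCommutativeSemigroup = isCommutativeSemigroup }

  open import Algebra.Properties.CommutativeSemigroup commutativeSemigroup using (interchange)

  ∑ : ℕ → (ℕ → A) → A
  ∑ zero f = ε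
  ∑ (suc n) f = ∑ n f ∙ f (suc n)

  ∑-cong : ∀ n {f h : ℕ → A} → (∀ d → 1 ≤ d → d ≤ n → f d ≡ h d) → ∑ n f ≡ ∑ n h
  ∑-cong zero f≗h = refl
  ∑-cong (suc n) f≗h =
    cong₂ _∙_ (∑-cong n (λ d 1≤d d≤n → f≗h d 1≤d (m≤n⇒m≤1+n d≤n)))
              (f≗h (suc n) (s≤s z≤n) ≤-refl)

  ∑-distrib : ∀ n f h → ∑ n (λ d → f d ∙ h d) ≡ ∑ n f ∙ ∑ n h
  ∑-distrib zero f h = sym (identityˡ ε)
  ∑-distrib (suc n) f h = trans (cong (_∙ (f (suc n) ∙ h (suc n))) (∑-distrib n f h))
                                (interchange (∑ n f) (∑ n h) (f (suc n)) (h (suc n)))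

  ∑-homomorphic : ∀ (h : A → A) → h ε ≡ ε → (∀ x y → h (x ∙ y) ≡ h x ∙ h y) →
                  ∀ n f → h (∑ n f) ≡ ∑ n (h ∘ f)
  ∑-homomorphic h hε≡ε h-∙ zero f = hε≡ε
  ∑-homomorphic h hε≡ε h-∙ (suc n) f =
    trans (h-∙ (∑ n f) (f (suc n))) (cong (_∙ h (f (suc n))) (∑-homomorphic h hε≡ε h-∙ n f))

  ∑-ε : ∀ n f → (∀ d → 1 ≤ d → d ≤ n → f d ≡ ε) → ∑ n f ≡ ε
  ∑-ε n f f≗ε = trans (∑-cong n f≗ε) (ε-sum n)
    where
    ε-sum : ∀ n → ∑ n (λ _ → ε) ≡ ε
    ε-sum zero = refl
    ε-sum (suc n) = trans (identityʳ _) (ε-sum n)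

  ∑-single : ∀ n t f → 1 ≤ t → t ≤ n → (∀ d → 1 ≤ d → d ≤ n → d ≢ t → f d ≡ ε) →
             ∑ n f ≡ f t
  ∑-single zero t f () z≤n _
  ∑-single (suc n) t f 1≤t t≤1+n others with t ≟ suc n
  ... | yes refl =
    trans (cong (_∙ f t) (∑-ε n f (λ d 1≤d d≤n → others d 1≤d (m≤n⇒m≤1+n d≤n) (<⇒≢ (s≤s d≤n)))))
          (identityˡ _)
  ... | no t≢1+n = trans (cong₂ _∙_ (∑-single n t f 1≤t (≤-pred (≤∧≢⇒< t≤1+n t≢1+n))
                                                  (λ d 1≤d d≤n → others d 1≤d (m≤n⇒m≤1+n d≤n)))
                                    (others (suc n) (s≤s z≤n) ≤-refl (t≢1+n ∘ sym)))
                         (identityʳ _)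

  ∑-update : ∀ n t c f h → 1 ≤ t → t ≤ n → (∀ d → d ≢ t → f d ≡ h d) → f t ≡ c ∙ h t →
             ∑ n f ≡ c ∙ ∑ n h
  ∑-update n t c f h 1≤t t≤n f≗h f[t] = begin
    ∑ n f                                    ≡⟨ ∑-cong n (λ d _ _ → split d) ⟩
    ∑ n (λ d → (c if d ≟ t else ε) ∙ h d)    ≡⟨ ∑-distrib n _ h ⟩
    ∑ n (λ d → c if d ≟ t else ε) ∙ ∑ n h
      ≡⟨ cong (_∙ ∑ n h) (∑-single n t _ 1≤t t≤n (λ d _ _ → if-no (d ≟ t))) ⟩
    (c if t ≟ t else ε) ∙ ∑ n h              ≡⟨ cong (_∙ ∑ n h) (if-yes (t ≟ t) refl) ⟩
    c ∙ ∑ n h                                ∎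
    where
    open ≡-Reasoning
    split : ∀ d → f d ≡ (c if d ≟ t else ε) ∙ h d
    split d with d ≟ t
    ... | yes refl = f[t]
    ... | no d≢t = trans (f≗h d d≢t) (sym (identityˡ (h d)))

  ∑-extend : ∀ m n f → m ≤ n → (∀ d → m < d → d ≤ n → f d ≡ ε) → ∑ n f ≡ ∑ m f
  ∑-extend m zero f z≤n _ = refl
  ∑-extend m (suc n) f m≤1+n beyond with m ≟ suc n
  ... | yes refl = refl
  ... | no m≢1+n = trans (cong₂ _∙_ (∑-extend m n f m≤n (λ d m<d d≤n → beyond d m<d (m≤n⇒m≤1+n d≤n)))
                                     (beyond (suc n) (s≤s m≤n) ≤-refl))
                          (identityʳ _)
    where m≤n = ≤-pred (≤∧≢⇒< m≤1+n m≢1+n)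

  ∑-comm : ∀ m n (f : ℕ → ℕ → A) → ∑ m (λ a → ∑ n (f a)) ≡ ∑ n (λ b → ∑ m (λ a → f a b))
  ∑-comm zero n f = sym (∑-ε n _ (λ _ _ _ → refl))
  ∑-comm (suc m) n f = trans (cong (_∙ ∑ n (f (suc m))) (∑-comm m n f))
                             (sym (∑-distrib n (λ b → ∑ m (λ a → f a b)) (f (suc m))))

  if-∙ : (P? : Dec P) (x y : A) → (x ∙ y if P? else ε) ≡ (x if P? else ε) ∙ (y if P? else ε)
  if-∙ (yes _) x y = refl
  if-∙ (no _) x y = sym (identityˡ ε)

  ∑-if : ∀ n (P? : Dec P) F → (∑ n F if P? else ε) ≡ ∑ n (λ x → F x if P? else ε)
  ∑-if n (yes _) F = refl
  ∑-if n (no _) F = sym (∑-ε n _ (λ _ _ _ → refl))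

  if-≢ : ∀ {t u x} (Q? : Dec P) → t ≢ u → ((x if t ≟ u else ε) if Q? else ε) ≡ ε
  if-≢ {t = t} {u} Q? t≢u = trans (cong (_if Q? else ε) (if-no (t ≟ u) t≢u)) (if-same Q?)

  -- only the term a = t survives; the hypothesis on Q t covers t > n, where that term is absent
  ∑-select : ∀ n t {Q : ℕ → Set} (Q? : Decidable Q) x → 1 ≤ t → (n < t → ¬ Q t) →
             ∑ n (λ a → (x if t ≟ a else ε) if Q? a else ε) ≡ (x if Q? t else ε)
  ∑-select n t Q? x 1≤t Q⇒t≤n with t ℕ.≤? n
  ... | yes t≤n = trans (∑-single n t _ 1≤t t≤n (λ a _ _ a≢t → if-≢ (Q? a) (a≢t ∘ sym)))
                        (cong (_if Q? t else ε) (if-yes (t ≟ t) refl))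
  ... | no t≰n = trans (∑-ε n _ (λ a _ a≤n → if-≢ (Q? a) (λ t≡a → t≰n (subst (_≤ n) (sym t≡a) a≤n))))
                       (sym (if-no (Q? t) (Q⇒t≤n (ℕₚ.≰⇒> t≰n))))

  foldr-++ : ∀ xs ys → foldr _∙_ ε (xs ++ ys) ≡ foldr _∙_ ε xs ∙ foldr _∙_ ε ys
  foldr-++ [] ys = sym (identityˡ _)
  foldr-++ (x ∷ xs) ys = trans (cong (x ∙_) (foldr-++ xs ys)) (sym (assoc x _ _))

  foldr-range1 : ∀ n f → foldr _∙_ ε (map f (range1 n)) ≡ ∑ n f
  foldr-range1 zero f = refl
  foldr-range1 (suc n) f = begin
    foldr _∙_ ε (map f (range1 (suc n)))               ≡⟨ cong (foldr _∙_ ε ∘ map f) range1-suc ⟩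
    foldr _∙_ ε (map f (range1 n ++ suc n ∷ []))       ≡⟨ cong (foldr _∙_ ε) (map-++ f (range1 n) _) ⟩
    foldr _∙_ ε (map f (range1 n) ++ f (suc n) ∷ [])   ≡⟨ foldr-++ (map f (range1 n)) _ ⟩
    foldr _∙_ ε (map f (range1 n)) ∙ (f (suc n) ∙ ε)   ≡⟨ cong₂ _∙_ (foldr-range1 n f) (identityʳ _) ⟩
    ∑ (suc n) f                                         ∎
    where
    open ≡-Reasoning
    range1-suc : range1 (suc n) ≡ range1 n ++ suc n ∷ []
    range1-suc = trans (cong (map suc) (sym (upTo-∷ʳ n))) (map-++ suc (upTo n) (n ∷ []))

  foldr-filter : ∀ {B : Set} {P : B → Set} (P? : Decidable P) (h : B → A) xs →
    foldr _∙_ ε (map h (filter P? xs)) ≡ foldr _∙_ ε (map (λ x → h x if P? x else ε) xs)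
  foldr-filter P? h [] = refl
  foldr-filter P? h (x ∷ xs) with P? x
  ... | yes _ = cong (h x ∙_) (foldr-filter P? h xs)
  ... | no _ = trans (foldr-filter P? h xs) (sym (identityˡ _))

-- Primes, valuations, Ω and ω

module ℕ+ = RangeSum ℕₚ.+-0-isCommutativeMonoid
module ℕ* = RangeSum ℕₚ.*-1-isCommutativeMonoid

*-positiveˡ : ∀ m {k} → 1 ≤ m ℕ.* k → 1 ≤ m
*-positiveˡ (suc _) _ = s≤s z≤n

*-positiveʳ : ∀ m {k} → 1 ≤ m ℕ.* k → 1 ≤ k
*-positiveʳ m {k} 1≤mk = *-positiveˡ k (subst (1 ≤_) (ℕₚ.*-comm m k) 1≤mk)

-- n / d, totalised by n ÷ 0 = n so that no NonZero instance is needed under binders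
_÷_ : ℕ → ℕ → ℕ
n ÷ d = n / suc (d ∸ 1)

*÷ : ∀ q d → 1 ≤ d → (q ℕ.* d) ÷ d ≡ q
*÷ q (suc d) _ = m*n/n≡m q (suc d)

n≡d*[n÷d] : ∀ {n d} → 1 ≤ d → d ∣ n → n ≡ d ℕ.* (n ÷ d)
n≡d*[n÷d] {d = d} 1≤d (divides q refl) = trans (ℕₚ.*-comm q d) (cong (d ℕ.*_) (sym (*÷ q d 1≤d)))

÷-positive : ∀ {n d} → 1 ≤ n → 1 ≤ d → d ∣ n → 1 ≤ n ÷ d
÷-positive {d = d} 1≤n 1≤d d∣n = *-positiveʳ d (subst (1 ≤_) (n≡d*[n÷d] 1≤d d∣n) 1≤n)

length-filter-range1 : ∀ n {P : ℕ → Set} (P? : Decidable P) →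
                       length (filter P? (range1 n)) ≡ ℕ+.∑ n (λ d → 1 if P? d else 0)
length-filter-range1 n P? = trans (length≡sum-of-ones (filter P? (range1 n)))
                                  (trans (ℕ+.foldr-filter P? (λ _ → 1) (range1 n)) (ℕ+.foldr-range1 n _))
  where
  length≡sum-of-ones : ∀ (xs : List ℕ) → length xs ≡ sum (map (λ _ → 1) xs)
  length≡sum-of-ones [] = refl
  length≡sum-of-ones (_ ∷ xs) = cong suc (length≡sum-of-ones xs)

prime>1 : ∀ {p} → Prime p → 1 < p
prime>1 {p} p-prime = ℕ.nonTrivial⇒n>1 p {{prime⇒nonTrivial p-prime}}

prime>0 : ∀ {p} → Prime p → 0 < p
prime>0 p-prime = ≤-trans (s≤s z≤n) (prime>1 p-prime)

prime∣prime⇒≡ : ∀ {p q} → Prime p → Prime q → q ∣ p → q ≡ p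
prime∣prime⇒≡ p-prime q-prime q∣p with prime⇒irreducible p-prime q∣p
... | inj₁ refl = contradiction q-prime ¬prime[1]
... | inj₂ q≡p = q≡p

∃-prime-divisor : ∀ n → 1 < n → ∃ λ p → Prime p × p ∣ n
∃-prime-divisor n 1<n = first-factor (factorise n {{>-nonZero (≤-trans (s≤s z≤n) 1<n)}})
  where
  first-factor : PrimeFactorisation n → ∃ λ p → Prime p × p ∣ n
  first-factor record { factors = [] ; isFactorisation = n≡1 } = contradiction (sym n≡1) (ℕₚ.<⇒≢ 1<n)
  first-factor record { factors = p ∷ ps ; isFactorisation = n≡p*ps ; factorsPrime = p-prime All.∷ _ } =
    p , p-prime , subst (p ∣_) (sym n≡p*ps) (ℕᵈ.m∣m*n (product ps))

infix 4 _^_∥_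
record _^_∥_ (q v n : ℕ) : Set where
  constructor exactly
  field
    divides-power : q ^ v ∣ n
    ¬divides-next : q ^ suc v ∤ n

∃-∥ : ∀ {q} n → 1 < q → 1 ≤ n → ∃ λ v → q ^ v ∥ n
∃-∥ {q} n 1<q 1≤n = go n (<-wellFounded n) 1≤n
  where
  instance _ = >-nonZero (≤-trans (s≤s z≤n) 1<q)
  go : ∀ n → Acc _<_ n → 1 ≤ n → ∃ λ v → q ^ v ∥ n
  go n _ _ with q ∣? n
  go n _ _ | no q∤n = 0 , exactly (ℕᵈ.1∣ n) (q∤n ∘ subst (_∣ n) (ℕₚ.*-identityʳ q))
  go n (acc smaller) 1≤n | yes (divides m n≡mq) with go m (smaller m<n) 1≤m
    where
    1≤m = *-positiveˡ m (subst (1 ≤_) n≡mq 1≤n)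
    m<n = subst (m <_) (sym n≡mq) (ℕₚ.m<m*n m q {{>-nonZero 1≤m}} 1<q)
  ... | v , exactly q^v∣m q^1+v∤m = suc v , exactly q^1+v∣n q^2+v∤n
    where
    n≡qm = trans n≡mq (ℕₚ.*-comm m q)
    q^1+v∣n = subst (q ^ suc v ∣_) (sym n≡qm) (ℕᵈ.*-monoʳ-∣ q q^v∣m)
    q^2+v∤n = q^1+v∤m ∘ ℕᵈ.*-cancelˡ-∣ q ∘ subst (q ℕ.* q ^ suc v ∣_) n≡qm

n<q^n : ∀ {q} n → 1 < q → n < q ^ n
n<q^n zero _ = s≤s z≤n
n<q^n {q} (suc n) 1<q = ℕₚ.≤-<-trans (n<q^n n 1<q) (ℕₚ.^-monoʳ-< q 1<q (ℕₚ.n<1+n n))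

^-monoʳ-∣ : ∀ q {k v} → k ≤ v → q ^ k ∣ q ^ v
^-monoʳ-∣ q {k} {v} k≤v = subst (λ t → q ^ k ∣ q ^ t) (ℕₚ.m+[n∸m]≡n k≤v)
  (subst (q ^ k ∣_) (sym (ℕₚ.^-distribˡ-+-* q k (v ∸ k))) (ℕᵈ.m∣m*n (q ^ (v ∸ k))))

-- mult q n counts the k ∈ [1, n] with q ^ k ∣ n, that is, k ≤ v
mult-∥ : ∀ {q n v} → 1 < q → 1 ≤ n → q ^ v ∥ n → mult q n ≡ v
mult-∥ {q} {n} {v} 1<q 1≤n (exactly q^v∣n q^1+v∤n) = begin
  mult q n
    ≡⟨ length-filter-range1 n (λ k → q ^ k ∣? n) ⟩
  ℕ+.∑ n (λ k → 1 if q ^ k ∣? n else 0)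
    ≡⟨ ℕ+.∑-cong n (λ k _ _ → if-⇔ (q ^ k ∣? n) (k ℕ.≤? v) ∣⇒≤v ≤v⇒∣ refl) ⟩
  ℕ+.∑ n (λ k → 1 if k ℕ.≤? v else 0)
    ≡⟨ ℕ+.∑-extend v n _ v≤n (λ k v<k _ → if-no (k ℕ.≤? v) (ℕₚ.<⇒≱ v<k)) ⟩
  ℕ+.∑ v (λ k → 1 if k ℕ.≤? v else 0)
    ≡⟨ ℕ+.∑-cong v (λ k _ k≤v → if-yes (k ℕ.≤? v) k≤v) ⟩
  ℕ+.∑ v (λ _ → 1)
    ≡⟨ ∑-ones v ⟩
  v ∎
  where
  open ≡-Reasoning
  ∣⇒≤v : ∀ {k} → q ^ k ∣ n → k ≤ v
  ∣⇒≤v {k} q^k∣n with k ℕ.≤? v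
  ... | yes k≤v = k≤v
  ... | no k≰v = contradiction (ℕᵈ.∣-trans (^-monoʳ-∣ q (ℕₚ.≰⇒> k≰v)) q^k∣n) q^1+v∤n
  ≤v⇒∣ : ∀ {k} → k ≤ v → q ^ k ∣ n
  ≤v⇒∣ k≤v = ℕᵈ.∣-trans (^-monoʳ-∣ q k≤v) q^v∣n
  v≤n : v ≤ n
  v≤n = ℕₚ.<⇒≤ (<-≤-trans (n<q^n v 1<q) (ℕᵈ.∣⇒≤ {{>-nonZero 1≤n}} q^v∣n))
  ∑-ones : ∀ m → ℕ+.∑ m (λ _ → 1) ≡ m
  ∑-ones zero = refl
  ∑-ones (suc m) = trans (cong (ℕ._+ 1) (∑-ones m)) (ℕₚ.+-comm m 1)

∥-* : ∀ {q a b i j} → Prime q → q ^ i ∥ a → q ^ j ∥ b → q ^ (i ℕ.+ j) ∥ a ℕ.* b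
∥-* {q} {a} {b} {i} {j} q-prime (exactly (divides x a≡xq^i) q^1+i∤a) (exactly (divides y b≡yq^j) q^1+j∤b) =
  exactly (divides (x ℕ.* y) ab≡xyq^ij) q^1+ij∤ab
  where
  instance _ = ℕₚ.m^n≢0 q (i ℕ.+ j) {{prime⇒nonZero q-prime}}
  ab≡xyq^ij : a ℕ.* b ≡ x ℕ.* y ℕ.* q ^ (i ℕ.+ j)
  ab≡xyq^ij = trans (cong₂ ℕ._*_ a≡xq^i b≡yq^j)
    (trans (ℕ*-Props.interchange x (q ^ i) y (q ^ j)) (cong (x ℕ.* y ℕ.*_) (sym (ℕₚ.^-distribˡ-+-* q i j))))
  cofactor-∤ : ∀ {c z k} → c ≡ z ℕ.* q ^ k → q ^ suc k ∤ c → q ∤ z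
  cofactor-∤ {k = k} c≡zq^k q^1+k∤c (divides w z≡wq) =
    q^1+k∤c (divides w (trans c≡zq^k (trans (cong (ℕ._* q ^ k) z≡wq) (ℕₚ.*-assoc w q (q ^ k)))))
  q^1+ij∤ab : q ^ suc (i ℕ.+ j) ∤ a ℕ.* b
  q^1+ij∤ab q^1+ij∣ab with euclidsLemma x y q-prime (ℕᵈ.*-cancelˡ-∣ (q ^ (i ℕ.+ j))
    (subst₂ _∣_ (ℕₚ.*-comm q (q ^ (i ℕ.+ j))) (trans ab≡xyq^ij (ℕₚ.*-comm (x ℕ.* y) _)) q^1+ij∣ab))
  ... | inj₁ q∣x = cofactor-∤ {k = i} a≡xq^i q^1+i∤a q∣x
  ... | inj₂ q∣y = cofactor-∤ {k = j} b≡yq^j q^1+j∤b q∣y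

mult-* : ∀ {q a b} → Prime q → 1 ≤ a → 1 ≤ b → mult q (a ℕ.* b) ≡ mult q a ℕ.+ mult q b
mult-* {q} {a} {b} q-prime 1≤a 1≤b
  with ∃-∥ a (prime>1 q-prime) 1≤a | ∃-∥ b (prime>1 q-prime) 1≤b
... | i , q^i∥a | j , q^j∥b =
  trans (mult-∥ (prime>1 q-prime) (ℕₚ.*-mono-≤ 1≤a 1≤b) (∥-* q-prime q^i∥a q^j∥b))
        (sym (cong₂ ℕ._+_ (mult-∥ (prime>1 q-prime) 1≤a q^i∥a) (mult-∥ (prime>1 q-prime) 1≤b q^j∥b)))

mult-∤ : ∀ {q n} → 1 < q → 1 ≤ n → q ∤ n → mult q n ≡ 0
mult-∤ {q} {n} 1<q 1≤n q∤n =
  mult-∥ 1<q 1≤n (exactly (ℕᵈ.1∣ n) (q∤n ∘ subst (_∣ n) (ℕₚ.*-identityʳ q)))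

mult-∣∤² : ∀ {q n} → 1 < q → 1 ≤ n → q ∣ n → q ℕ.* q ∤ n → mult q n ≡ 1
mult-∣∤² {q} {n} 1<q 1≤n q∣n q²∤n =
  mult-∥ 1<q 1≤n (exactly (subst (_∣ n) (sym (ℕₚ.*-identityʳ q)) q∣n)
                          (q²∤n ∘ subst (_∣ n) (cong (q ℕ.*_) (ℕₚ.*-identityʳ q))))

mult-self : ∀ {p} → Prime p → mult p p ≡ 1
mult-self {p} p-prime = mult-∣∤² (prime>1 p-prime) (prime>0 p-prime) ℕᵈ.∣-refl p²∤p
  where
  p²∤p : p ℕ.* p ∤ p
  p²∤p p²∣p = ℕₚ.<⇒≱ (ℕₚ.m<m*n p p {{prime⇒nonZero p-prime}} (prime>1 p-prime))
                     (ℕᵈ.∣⇒≤ {{prime⇒nonZero p-prime}} p²∣p)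

module OverPrimes {A : Set} {_∙_ : A → A → A} {ε : A} (isCM : IsCommutativeMonoid _≡_ _∙_ ε) where
  open RangeSum isCM

  -- primes q ∤ n contribute φ (mult q n) = φ 0 = ε, so the range of primes can be enlarged at will
  foldr-primeDivisors : ∀ {n M} (φ : ℕ → A) → φ 0 ≡ ε → 1 ≤ n → n ≤ M →
    foldr _∙_ ε (map (λ p → φ (mult p n)) (primeDivisors n)) ≡ ∑ M (λ q → φ (mult q n) if prime? q else ε)
  foldr-primeDivisors {n} {M} φ φ0≡ε 1≤n n≤M = begin
    foldr _∙_ ε (map (λ p → φ (mult p n)) (primeDivisors n))
      ≡⟨ foldr-filter (λ p → prime? p ×-dec p ∣? n) _ (range1 n) ⟩
    foldr _∙_ ε (map (λ q → φ (mult q n) if prime? q ×-dec q ∣? n else ε) (range1 n))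
      ≡⟨ foldr-range1 n _ ⟩
    ∑ n (λ q → φ (mult q n) if prime? q ×-dec q ∣? n else ε)
      ≡⟨ ∑-cong n (λ q _ _ → trans (if-×-dec (prime? q) (q ∣? n)) (drop-∣ q)) ⟩
    ∑ n (λ q → φ (mult q n) if prime? q else ε)
      ≡⟨ ∑-extend n M _ n≤M (λ q n<q _ → vanish q (ℕᵈ.>⇒∤ {{>-nonZero 1≤n}} n<q)) ⟨
    ∑ M (λ q → φ (mult q n) if prime? q else ε) ∎
    where
    open ≡-Reasoning
    vanish : ∀ q → q ∤ n → (φ (mult q n) if prime? q else ε) ≡ ε
    vanish q q∤n with prime? q
    ... | yes q-prime = trans (cong φ (mult-∤ (prime>1 q-prime) 1≤n q∤n)) φ0≡ε
    ... | no _ = refl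
    drop-∣ : ∀ q → ((φ (mult q n) if q ∣? n else ε) if prime? q else ε) ≡ (φ (mult q n) if prime? q else ε)
    drop-∣ q with q ∣? n
    ... | yes _ = refl
    ... | no q∤n = trans (if-same (prime? q)) (sym (vanish q q∤n))

module ℕ+ₚ = OverPrimes ℕₚ.+-0-isCommutativeMonoid
module ℕ*ₚ = OverPrimes ℕₚ.*-1-isCommutativeMonoid

Ω-∑ : ∀ {n} M → 1 ≤ n → n ≤ M → Ω n ≡ ℕ+.∑ M (λ q → mult q n if prime? q else 0)
Ω-∑ M = ℕ+ₚ.foldr-primeDivisors (λ α → α) refl

Ω-* : ∀ {a b} → 1 ≤ a → 1 ≤ b → Ω (a ℕ.* b) ≡ Ω a ℕ.+ Ω b
Ω-* {a} {b} 1≤a 1≤b = begin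
  Ω (a ℕ.* b)
    ≡⟨ Ω-∑ (a ℕ.* b) (ℕₚ.*-mono-≤ 1≤a 1≤b) ≤-refl ⟩
  ℕ+.∑ (a ℕ.* b) (λ q → mult q (a ℕ.* b) if prime? q else 0)
    ≡⟨ ℕ+.∑-cong (a ℕ.* b) (λ q _ _ → split q) ⟩
  ℕ+.∑ (a ℕ.* b) (λ q → (mult q a if prime? q else 0) ℕ.+ (mult q b if prime? q else 0))
    ≡⟨ ℕ+.∑-distrib (a ℕ.* b) _ _ ⟩
  ℕ+.∑ (a ℕ.* b) (λ q → mult q a if prime? q else 0)
    ℕ.+ ℕ+.∑ (a ℕ.* b) (λ q → mult q b if prime? q else 0)
    ≡⟨ cong₂ ℕ._+_ (Ω-∑ (a ℕ.* b) 1≤a (ℕₚ.m≤m*n a b {{>-nonZero 1≤b}}))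
                   (Ω-∑ (a ℕ.* b) 1≤b (ℕₚ.m≤n*m b a {{>-nonZero 1≤a}})) ⟨
  Ω a ℕ.+ Ω b ∎
  where
  open ≡-Reasoning
  split : ∀ q → (mult q (a ℕ.* b) if prime? q else 0)
              ≡ (mult q a if prime? q else 0) ℕ.+ (mult q b if prime? q else 0)
  split q with prime? q
  ... | yes q-prime = mult-* q-prime 1≤a 1≤b
  ... | no _ = refl

Ω-prime : ∀ {p} → Prime p → Ω p ≡ 1
Ω-prime {p} p-prime =
  trans (Ω-∑ p (prime>0 p-prime) ≤-refl)
        (trans (ℕ+.∑-single p p _ (prime>0 p-prime) ≤-refl (λ q _ _ q≢p → other q q≢p))
               (trans (if-yes (prime? p) p-prime) (mult-self p-prime)))
  where
  other : ∀ q → q ≢ p → (mult q p if prime? q else 0) ≡ 0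
  other q q≢p with prime? q
  ... | yes q-prime = mult-∤ (prime>1 q-prime) (prime>0 p-prime) (q≢p ∘ prime∣prime⇒≡ p-prime q-prime)
  ... | no _ = refl

Ω-÷ : ∀ {n p} → 1 ≤ n → Prime p → p ∣ n → Ω n ≡ suc (Ω (n ÷ p))
Ω-÷ {n} {p} 1≤n p-prime p∣n = begin
  Ω n                      ≡⟨ cong Ω (n≡d*[n÷d] (prime>0 p-prime) p∣n) ⟩
  Ω (p ℕ.* (n ÷ p))        ≡⟨ Ω-* (prime>0 p-prime) (÷-positive 1≤n (prime>0 p-prime) p∣n) ⟩
  Ω p ℕ.+ Ω (n ÷ p)        ≡⟨ cong (ℕ._+ Ω (n ÷ p)) (Ω-prime p-prime) ⟩
  suc (Ω (n ÷ p))          ∎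
  where open ≡-Reasoning

ω-∑ : ∀ {n} M → 1 ≤ n → n ≤ M → ω n ≡ ℕ+.∑ M (λ q → 1 if prime? q ×-dec q ∣? n else 0)
ω-∑ {n} M 1≤n n≤M =
  trans (length-filter-range1 n (λ p → prime? p ×-dec p ∣? n))
        (sym (ℕ+.∑-extend n M _ n≤M (λ q n<q _ → trans (if-×-dec (prime? q) (q ∣? n))
               (trans (cong (_if prime? q else 0) (if-no (q ∣? n) (ℕᵈ.>⇒∤ {{>-nonZero 1≤n}} n<q)))
                      (if-same (prime? q))))))

Ω≡∑mult : ∀ n → Ω n ≡ ℕ+.∑ n (λ q → mult q n if prime? q ×-dec q ∣? n else 0)
Ω≡∑mult n = trans (ℕ+.foldr-filter (λ p → prime? p ×-dec p ∣? n) (λ p → mult p n) (range1 n))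
                  (ℕ+.foldr-range1 n _)

-- The multinomial coefficient CΩ

multFactorials : ℕ → ℕ
multFactorials n = prodFact (map (λ p → mult p n) (primeDivisors n))

multFactorials-∏ : ∀ {n} M → 1 ≤ n → n ≤ M →
                   multFactorials n ≡ ℕ*.∑ M (λ q → mult q n ! if prime? q else 1)
multFactorials-∏ {n} M 1≤n n≤M =
  trans (prodFact-map (primeDivisors n)) (ℕ*ₚ.foldr-primeDivisors _! refl 1≤n n≤M)
  where
  prodFact-map : ∀ ps → prodFact (map (λ p → mult p n) ps) ≡ foldr ℕ._*_ 1 (map (λ p → mult p n !) ps)
  prodFact-map [] = refl
  prodFact-map (p ∷ ps) = cong (mult p n ! ℕ.*_) (prodFact-map ps)

multFactorials-÷ : ∀ {n p} → 1 ≤ n → Prime p → p ∣ n →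
                   multFactorials n ≡ mult p n ℕ.* multFactorials (n ÷ p)
multFactorials-÷ {n} {p} 1≤n p-prime p∣n = begin
  multFactorials n
    ≡⟨ multFactorials-∏ n 1≤n ≤-refl ⟩
  ℕ*.∑ n (λ q → mult q n ! if prime? q else 1)
    ≡⟨ ℕ*.∑-update n p (mult p n) _ _ (prime>0 p-prime) (ℕᵈ.∣⇒≤ {{>-nonZero 1≤n}} p∣n) other at-p ⟩
  mult p n ℕ.* ℕ*.∑ n (λ q → mult q m ! if prime? q else 1)
    ≡⟨ cong (mult p n ℕ.*_) (multFactorials-∏ n 1≤m m≤n) ⟨
  mult p n ℕ.* multFactorials m ∎
  where
  open ≡-Reasoning
  m = n ÷ p
  1≤m = ÷-positive 1≤n (prime>0 p-prime) p∣n
  m≤n = subst (m ≤_) (sym (n≡d*[n÷d] (prime>0 p-prime) p∣n)) (ℕₚ.m≤n*m m p {{prime⇒nonZero p-prime}})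
  mult-n : ∀ {q} → Prime q → mult q n ≡ mult q p ℕ.+ mult q m
  mult-n q-prime = trans (cong (mult _) (n≡d*[n÷d] (prime>0 p-prime) p∣n)) (mult-* q-prime (prime>0 p-prime) 1≤m)
  other : ∀ q → q ≢ p → (mult q n ! if prime? q else 1) ≡ (mult q m ! if prime? q else 1)
  other q q≢p with prime? q
  ... | yes q-prime = cong _! (trans (mult-n q-prime) (cong (ℕ._+ mult q m) q∤p))
    where q∤p = mult-∤ (prime>1 q-prime) (prime>0 p-prime) (q≢p ∘ prime∣prime⇒≡ p-prime q-prime)
  ... | no _ = refl
  mult-n≡1+mult-m : mult p n ≡ suc (mult p m)
  mult-n≡1+mult-m = trans (mult-n p-prime) (cong (ℕ._+ mult p m) (mult-self p-prime))
  at-p : (mult p n ! if prime? p else 1) ≡ mult p n ℕ.* (mult p m ! if prime? p else 1)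
  at-p = begin
    (mult p n ! if prime? p else 1)               ≡⟨ if-yes (prime? p) p-prime ⟩
    mult p n !                                    ≡⟨ cong _! mult-n≡1+mult-m ⟩
    suc (mult p m) ℕ.* mult p m !                 ≡⟨ cong (ℕ._* mult p m !) mult-n≡1+mult-m ⟨
    mult p n ℕ.* mult p m !                       ≡⟨ cong (mult p n ℕ.*_) (if-yes (prime? p) p-prime) ⟨
    mult p n ℕ.* (mult p m ! if prime? p else 1)  ∎

∑-*ℕ : ∀ n c f → ℕ+.∑ n f ℕ.* c ≡ ℕ+.∑ n (λ d → f d ℕ.* c)
∑-*ℕ n c = ℕ+.∑-homomorphic (ℕ._* c) refl (λ x y → ℕₚ.*-distribʳ-+ c x y) n

primeCofactorSum : (ℕ → ℕ) → ℕ → ℕ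
primeCofactorSum f n = ℕ+.∑ n (λ q → f (n ÷ q) if prime? q ×-dec q ∣? n else 0)

-- each term is CΩ(n/q) · ∏ α! = α_q · (Ω(n) - 1)!, and Σ_q α_q = Ω(n)
primeCofactorSum*multFactorials : ∀ {n} → 1 < n →
  (∀ m → m < n → 1 ≤ m → CΩ m ℕ.* multFactorials m ≡ Ω m !) →
  primeCofactorSum CΩ n ℕ.* multFactorials n ≡ Ω n !
primeCofactorSum*multFactorials {n} 1<n IH with ∃-prime-divisor n 1<n
... | p , p-prime , p∣n = begin
  primeCofactorSum CΩ n ℕ.* multFactorials n
    ≡⟨ ∑-*ℕ n (multFactorials n) _ ⟩
  ℕ+.∑ n (λ q → (CΩ (n ÷ q) if prime? q ×-dec q ∣? n else 0) ℕ.* multFactorials n)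
    ≡⟨ ℕ+.∑-cong n (λ q _ _ → term q) ⟩
  ℕ+.∑ n (λ q → (mult q n if prime? q ×-dec q ∣? n else 0) ℕ.* (Ω n ∸ 1) !)
    ≡⟨ ∑-*ℕ n ((Ω n ∸ 1) !) _ ⟨
  ℕ+.∑ n (λ q → mult q n if prime? q ×-dec q ∣? n else 0) ℕ.* (Ω n ∸ 1) !
    ≡⟨ cong (ℕ._* (Ω n ∸ 1) !) (Ω≡∑mult n) ⟨
  Ω n ℕ.* (Ω n ∸ 1) !
    ≡⟨ cong (λ k → k ℕ.* (k ∸ 1) !) (Ω-÷ 1≤n p-prime p∣n) ⟩
  suc (Ω (n ÷ p)) !
    ≡⟨ cong _! (Ω-÷ 1≤n p-prime p∣n) ⟨
  Ω n ! ∎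
  where
  open ≡-Reasoning
  1≤n = ≤-trans (s≤s z≤n) 1<n
  term : ∀ q → (CΩ (n ÷ q) if prime? q ×-dec q ∣? n else 0) ℕ.* multFactorials n
             ≡ (mult q n if prime? q ×-dec q ∣? n else 0) ℕ.* (Ω n ∸ 1) !
  term q with prime? q ×-dec q ∣? n
  ... | no _ = refl
  ... | yes (q-prime , q∣n) = begin
    CΩ m ℕ.* multFactorials n
      ≡⟨ cong (CΩ m ℕ.*_) (multFactorials-÷ 1≤n q-prime q∣n) ⟩
    CΩ m ℕ.* (mult q n ℕ.* multFactorials m)
      ≡⟨ ℕ*-Props.x∙yz≈y∙xz (CΩ m) (mult q n) (multFactorials m) ⟩
    mult q n ℕ.* (CΩ m ℕ.* multFactorials m)
      ≡⟨ cong (mult q n ℕ.*_) (IH m m<n 1≤m) ⟩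
    mult q n ℕ.* Ω m !
      ≡⟨ cong (λ k → mult q n ℕ.* (k ∸ 1) !) (Ω-÷ 1≤n q-prime q∣n) ⟨
    mult q n ℕ.* (Ω n ∸ 1) ! ∎
    where
    m = n ÷ q
    1≤m = ÷-positive 1≤n (prime>0 q-prime) q∣n
    m<n = subst (m <_) (trans (ℕₚ.*-comm m q) (sym (n≡d*[n÷d] (prime>0 q-prime) q∣n)))
                (ℕₚ.m<m*n m q {{>-nonZero 1≤m}} (prime>1 q-prime))

CΩ-unique : ∀ {n c} → c ℕ.* multFactorials n ≡ Ω n ! → CΩ n ≡ c
CΩ-unique {n} {c} c*A≡Ω! = trans (cong (λ x → (x / multFactorials n) {{A≢0}}) (sym c*A≡Ω!))
                                (m*n/n≡m c (multFactorials n) {{A≢0}})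
  where A≢0 = prodFact≢0 (map (λ p → mult p n) (primeDivisors n))

CΩ*multFactorials : ∀ n → 1 ≤ n → CΩ n ℕ.* multFactorials n ≡ Ω n !
CΩ*multFactorials n = go n (<-wellFounded n)
  where
  go : ∀ n → Acc _<_ n → 1 ≤ n → CΩ n ℕ.* multFactorials n ≡ Ω n !
  go (suc zero) _ _ = refl
  go n@(suc (suc _)) (acc smaller) _ =
    trans (cong (ℕ._* multFactorials n) (CΩ-unique {n} {primeCofactorSum CΩ n} c*A≡Ω!)) c*A≡Ω!
    where c*A≡Ω! = primeCofactorSum*multFactorials (s≤s (s≤s z≤n)) (λ m m<n → go m (smaller m<n))

CΩ-recurrence : ∀ {n} → 1 < n → CΩ n ≡ primeCofactorSum CΩ n
CΩ-recurrence {n} 1<n =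
  CΩ-unique {n} {primeCofactorSum CΩ n} (primeCofactorSum*multFactorials 1<n (λ m _ → CΩ*multFactorials m))

-- Dirichlet convolution

open RangeSum ℤₚ.+-0-isCommutativeMonoid

*-∑ : ∀ n c f → c * ∑ n f ≡ ∑ n (λ d → c * f d)
*-∑ n c = ∑-homomorphic (c *_) (ℤₚ.*-zeroʳ c) (ℤₚ.*-distribˡ-+ c) n

∑-* : ∀ n c f → ∑ n f * c ≡ ∑ n (λ d → f d * c)
∑-* n c = ∑-homomorphic (_* c) (ℤₚ.*-zeroˡ c) (ℤₚ.*-distribʳ-+ c) n

*-if : ∀ {p} {P : Set p} (P? : Dec P) c x → c * (x if P? else 0ℤ) ≡ (c * x if P? else 0ℤ)
*-if (yes _) c x = refl
*-if (no _) c x = ℤₚ.*-zeroʳ c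

if-* : ∀ {p} {P : Set p} (P? : Dec P) c x → (x if P? else 0ℤ) * c ≡ (x * c if P? else 0ℤ)
if-* (yes _) c x = refl
if-* (no _) c x = ℤₚ.*-zeroˡ c

divisorSum : ℕ → (ℕ → ℤ) → ℤ
divisorSum n F = ∑ n (λ d → F d if d ∣? n else 0ℤ)

sumℤ-divisors : ∀ n (F : ℕ → ℤ) →
  sumℤ (map (F ∘ suc) (filter (λ i → suc i ∣? n) (upTo n))) ≡ divisorSum n F
sumℤ-divisors n F =
  trans (foldr-filter (λ i → suc i ∣? n) (F ∘ suc) (upTo n))
        (trans (cong sumℤ (map-∘ (upTo n))) (foldr-range1 n (λ d → F d if d ∣? n else 0ℤ)))

infixl 7 _⋆_
_⋆_ : (ℕ → ℤ) → (ℕ → ℤ) → ℕ → ℤ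
(f ⋆ h) n = ∑ n λ a → ∑ n λ b → (f a * h b if a ℕ.* b ≟ n else 0ℤ)

⋆-divisorSum : ∀ f h n → (f ⋆ h) n ≡ divisorSum n (λ d → f d * h (n ÷ d))
⋆-divisorSum f h n = ∑-cong n inner
  where
  inner : ∀ a → 1 ≤ a → a ≤ n →
          ∑ n (λ b → f a * h b if a ℕ.* b ≟ n else 0ℤ) ≡ (f a * h (n ÷ a) if a ∣? n else 0ℤ)
  inner a 1≤a a≤n with a ∣? n
  ... | no a∤n = ∑-ε n _ (λ b _ _ → if-no (a ℕ.* b ≟ n)
                                       (λ ab≡n → a∤n (divides b (trans (sym ab≡n) (ℕₚ.*-comm a b)))))
  ... | yes a∣n@(divides q n≡qa) =
    trans (∑-single n q _ 1≤q q≤n (λ b _ _ b≢q → if-no (a ℕ.* b ≟ n) (b≢q ∘ cancel b)))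
          (trans (if-yes (a ℕ.* q ≟ n) (trans (ℕₚ.*-comm a q) (sym n≡qa)))
                 (cong (λ t → f a * h t) (sym (trans (cong (_÷ a) n≡qa) (*÷ q a 1≤a)))))
    where
    instance _ = >-nonZero 1≤a
    1≤q : 1 ≤ q
    1≤q = *-positiveˡ q (subst (1 ≤_) n≡qa (≤-trans 1≤a a≤n))
    q≤n : q ≤ n
    q≤n = subst (q ≤_) (sym n≡qa) (ℕₚ.m≤m*n q a)
    cancel : ∀ b → a ℕ.* b ≡ n → b ≡ q
    cancel b ab≡n = ℕₚ.*-cancelʳ-≡ b q a (trans (ℕₚ.*-comm b a) (trans ab≡n n≡qa))

dirichlet≡⋆ : ∀ f h n → dirichlet f h n ≡ (f ⋆ h) n
dirichlet≡⋆ f h n = trans (sumℤ-divisors n (λ d → f d * h (n ÷ d))) (sym (⋆-divisorSum f h n))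

⋆-comm : ∀ f h n → (f ⋆ h) n ≡ (h ⋆ f) n
⋆-comm f h n = trans (∑-comm n n _) (∑-cong n λ b _ _ → ∑-cong n λ a _ _ →
  if-⇔ (a ℕ.* b ≟ n) (b ℕ.* a ≟ n) (trans (ℕₚ.*-comm b a)) (trans (ℕₚ.*-comm a b))
       (ℤₚ.*-comm (f a) (h b)))

⋆-congˡ : ∀ n h {f f′} → (∀ d → 1 ≤ d → d ≤ n → f d ≡ f′ d) → (f ⋆ h) n ≡ (f′ ⋆ h) n
⋆-congˡ n h f≗f′ = ∑-cong n λ a 1≤a a≤n → ∑-cong n λ b _ _ →
  cong (λ x → x * h b if a ℕ.* b ≟ n else 0ℤ) (f≗f′ a 1≤a a≤n)

⋆-congʳ : ∀ n f {h h′} → (∀ d → 1 ≤ d → d ≤ n → h d ≡ h′ d) → (f ⋆ h) n ≡ (f ⋆ h′) n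
⋆-congʳ n f h≗h′ = ∑-cong n λ a _ _ → ∑-cong n λ b 1≤b b≤n →
  cong (λ x → f a * x if a ℕ.* b ≟ n else 0ℤ) (h≗h′ b 1≤b b≤n)

δ₁≢1 : ∀ {d} → d ≢ 1 → δ₁ d ≡ 0ℤ
δ₁≢1 {zero} _ = refl
δ₁≢1 {suc zero} d≢1 = contradiction refl d≢1
δ₁≢1 {suc (suc _)} _ = refl

divisorSum-δ₁ : ∀ n (F : ℕ → ℤ) → 1 ≤ n → divisorSum n (λ d → δ₁ d * F d) ≡ F 1
divisorSum-δ₁ n F 1≤n =
  trans (∑-single n 1 (λ d → δ₁ d * F d if d ∣? n else 0ℤ) ≤-refl 1≤n vanish)
        (trans (if-yes (1 ∣? n) (ℕᵈ.1∣ n)) (ℤₚ.*-identityˡ (F 1)))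
  where
  vanish : ∀ d → 1 ≤ d → d ≤ n → d ≢ 1 → (δ₁ d * F d if d ∣? n else 0ℤ) ≡ 0ℤ
  vanish d _ _ d≢1 = trans (cong (λ x → x * F d if d ∣? n else 0ℤ) (δ₁≢1 d≢1)) (if-same (d ∣? n))

⋆-identityˡ : ∀ f n → 1 ≤ n → (δ₁ ⋆ f) n ≡ f n
⋆-identityˡ f n 1≤n =
  trans (⋆-divisorSum δ₁ f n) (trans (divisorSum-δ₁ n (λ d → f (n ÷ d)) 1≤n) (cong f (n/1≡n n)))

⋆-identityʳ : ∀ f n → 1 ≤ n → (f ⋆ δ₁) n ≡ f n
⋆-identityʳ f n 1≤n = trans (⋆-comm f δ₁ n) (⋆-identityˡ f n 1≤n)

⋆-distribʳ-+ : ∀ f f′ h n → ((λ d → f d + f′ d) ⋆ h) n ≡ (f ⋆ h) n + (f′ ⋆ h) n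
⋆-distribʳ-+ f f′ h n = trans (∑-cong n λ a _ _ → trans (∑-cong n λ b _ _ → split a b) (∑-distrib n _ _))
                              (∑-distrib n _ _)
  where
  split : ∀ a b → ((f a + f′ a) * h b if a ℕ.* b ≟ n else 0ℤ)
                ≡ (f a * h b if a ℕ.* b ≟ n else 0ℤ) + (f′ a * h b if a ℕ.* b ≟ n else 0ℤ)
  split a b = trans (cong (_if a ℕ.* b ≟ n else 0ℤ) (ℤₚ.*-distribʳ-+ (h b) (f a) (f′ a)))
                    (if-∙ (a ℕ.* b ≟ n) _ _)

⋆-range : ∀ f h {a} M → a ≤ M →
          (f ⋆ h) a ≡ ∑ M λ c → ∑ M λ d → (f c * h d if c ℕ.* d ≟ a else 0ℤ)
⋆-range f h {a} M a≤M = sym (trans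
  (∑-extend a M _ a≤M λ c a<c _ → ∑-ε M _ λ d 1≤d _ → too-big (a<c⇒a<cd a<c 1≤d))
  (∑-cong a λ c 1≤c _ → ∑-extend a M _ a≤M λ d a<d _ → too-big (a<d⇒a<cd a<d 1≤c)))
  where
  too-big : ∀ {c d} → a < c ℕ.* d → (f c * h d if c ℕ.* d ≟ a else 0ℤ) ≡ 0ℤ
  too-big a<cd = if-no (_ ≟ a) (λ cd≡a → ℕₚ.<-irrefl (sym cd≡a) a<cd)
  a<c⇒a<cd : ∀ {c d} → a < c → 1 ≤ d → a < c ℕ.* d
  a<c⇒a<cd {c} {d} a<c 1≤d = <-≤-trans a<c (ℕₚ.m≤m*n c d {{>-nonZero 1≤d}})
  a<d⇒a<cd : ∀ {c d} → a < d → 1 ≤ c → a < c ℕ.* d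
  a<d⇒a<cd {c} {d} a<d 1≤c = <-≤-trans a<d (ℕₚ.m≤n*m d c {{>-nonZero 1≤c}})

⋆₃ : (ℕ → ℤ) → (ℕ → ℤ) → (ℕ → ℤ) → ℕ → ℤ
⋆₃ f h k n = ∑ n λ c → ∑ n λ d → ∑ n λ b → (f c * (h d * k b) if c ℕ.* (d ℕ.* b) ≟ n else 0ℤ)

⋆-assoc-⋆₃ˡ : ∀ f h k n → ((f ⋆ h) ⋆ k) n ≡ ⋆₃ f h k n
⋆-assoc-⋆₃ˡ f h k n = begin
  ((f ⋆ h) ⋆ k) n
    ≡⟨ (∑-cong n λ a _ a≤n → ∑-cong n λ b _ _ → expand a b a≤n) ⟩
  (∑ n λ a → ∑ n λ b → ∑ n λ c → ∑ n λ d → term a b c d)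
    ≡⟨ trans (∑-comm n n _) (∑-cong n λ b _ _ → trans (∑-comm n n _) (∑-cong n λ c _ _ → ∑-comm n n _)) ⟩
  (∑ n λ b → ∑ n λ c → ∑ n λ d → ∑ n λ a → term a b c d)
    ≡⟨ (∑-cong n λ b 1≤b _ → ∑-cong n λ c 1≤c _ → ∑-cong n λ d 1≤d _ →
         ∑-select n (c ℕ.* d) (λ a → a ℕ.* b ≟ n) _ (ℕₚ.*-mono-≤ 1≤c 1≤d) (too-big 1≤b)) ⟩
  (∑ n λ b → ∑ n λ c → ∑ n λ d → (f c * h d * k b if c ℕ.* d ℕ.* b ≟ n else 0ℤ))
    ≡⟨ trans (∑-comm n n _) (∑-cong n λ c _ _ → ∑-comm n n _) ⟩
  (∑ n λ c → ∑ n λ d → ∑ n λ b → (f c * h d * k b if c ℕ.* d ℕ.* b ≟ n else 0ℤ))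
    ≡⟨ (∑-cong n λ c _ _ → ∑-cong n λ d _ _ → ∑-cong n λ b _ _ →
         if-⇔ (c ℕ.* d ℕ.* b ≟ n) (c ℕ.* (d ℕ.* b) ≟ n) (trans (sym (ℕₚ.*-assoc c d b)))
              (trans (ℕₚ.*-assoc c d b)) (ℤₚ.*-assoc (f c) (h d) (k b))) ⟩
  ⋆₃ f h k n ∎
  where
  open ≡-Reasoning
  term : ℕ → ℕ → ℕ → ℕ → ℤ
  term a b c d = (f c * h d * k b if c ℕ.* d ≟ a else 0ℤ) if a ℕ.* b ≟ n else 0ℤ
  too-big : ∀ {b t} → 1 ≤ b → n < t → t ℕ.* b ≢ n
  too-big {b} {t} 1≤b n<t tb≡n = ℕₚ.<-irrefl (sym tb≡n) (<-≤-trans n<t (ℕₚ.m≤m*n t b {{>-nonZero 1≤b}}))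
  expand : ∀ a b → a ≤ n → ((f ⋆ h) a * k b if a ℕ.* b ≟ n else 0ℤ) ≡ ∑ n (λ c → ∑ n λ d → term a b c d)
  expand a b a≤n = begin
    ((f ⋆ h) a * k b if a ℕ.* b ≟ n else 0ℤ)
      ≡⟨ cong (λ x → x * k b if a ℕ.* b ≟ n else 0ℤ) (⋆-range f h n a≤n) ⟩
    (∑ n (λ c → ∑ n λ d → (f c * h d if c ℕ.* d ≟ a else 0ℤ)) * k b if a ℕ.* b ≟ n else 0ℤ)
      ≡⟨ cong (_if a ℕ.* b ≟ n else 0ℤ) (trans (∑-* n (k b) _) (∑-cong n λ c _ _ →
           trans (∑-* n (k b) _) (∑-cong n λ d _ _ → if-* (c ℕ.* d ≟ a) (k b) _))) ⟩
    (∑ n (λ c → ∑ n λ d → (f c * h d * k b if c ℕ.* d ≟ a else 0ℤ)) if a ℕ.* b ≟ n else 0ℤ)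
      ≡⟨ trans (∑-if n (a ℕ.* b ≟ n) _) (∑-cong n λ c _ _ → ∑-if n (a ℕ.* b ≟ n) _) ⟩
    ∑ n (λ c → ∑ n λ d → term a b c d) ∎

⋆-assoc-⋆₃ʳ : ∀ f h k n → (f ⋆ (h ⋆ k)) n ≡ ⋆₃ f h k n
⋆-assoc-⋆₃ʳ f h k n = begin
  (f ⋆ (h ⋆ k)) n
    ≡⟨ (∑-cong n λ c _ _ → ∑-cong n λ e _ e≤n → expand c e e≤n) ⟩
  (∑ n λ c → ∑ n λ e → ∑ n λ d → ∑ n λ b → term c e d b)
    ≡⟨ (∑-cong n λ c _ _ → trans (∑-comm n n _) (∑-cong n λ d _ _ → ∑-comm n n _)) ⟩
  (∑ n λ c → ∑ n λ d → ∑ n λ b → ∑ n λ e → term c e d b)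
    ≡⟨ (∑-cong n λ c 1≤c _ → ∑-cong n λ d 1≤d _ → ∑-cong n λ b 1≤b _ →
         ∑-select n (d ℕ.* b) (λ e → c ℕ.* e ≟ n) _ (ℕₚ.*-mono-≤ 1≤d 1≤b) (too-big 1≤c)) ⟩
  ⋆₃ f h k n ∎
  where
  open ≡-Reasoning
  term : ℕ → ℕ → ℕ → ℕ → ℤ
  term c e d b = (f c * (h d * k b) if d ℕ.* b ≟ e else 0ℤ) if c ℕ.* e ≟ n else 0ℤ
  too-big : ∀ {c t} → 1 ≤ c → n < t → c ℕ.* t ≢ n
  too-big {c} {t} 1≤c n<t ct≡n = ℕₚ.<-irrefl (sym ct≡n) (<-≤-trans n<t (ℕₚ.m≤n*m t c {{>-nonZero 1≤c}}))
  expand : ∀ c e → e ≤ n → (f c * (h ⋆ k) e if c ℕ.* e ≟ n else 0ℤ) ≡ ∑ n (λ d → ∑ n λ b → term c e d b)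
  expand c e e≤n = begin
    (f c * (h ⋆ k) e if c ℕ.* e ≟ n else 0ℤ)
      ≡⟨ cong (λ x → f c * x if c ℕ.* e ≟ n else 0ℤ) (⋆-range h k n e≤n) ⟩
    (f c * ∑ n (λ d → ∑ n λ b → (h d * k b if d ℕ.* b ≟ e else 0ℤ)) if c ℕ.* e ≟ n else 0ℤ)
      ≡⟨ cong (_if c ℕ.* e ≟ n else 0ℤ) (trans (*-∑ n (f c) _) (∑-cong n λ d _ _ →
           trans (*-∑ n (f c) _) (∑-cong n λ b _ _ → *-if (d ℕ.* b ≟ e) (f c) _))) ⟩
    (∑ n (λ d → ∑ n λ b → (f c * (h d * k b) if d ℕ.* b ≟ e else 0ℤ)) if c ℕ.* e ≟ n else 0ℤ)
      ≡⟨ trans (∑-if n (c ℕ.* e ≟ n) _) (∑-cong n λ d _ _ → ∑-if n (c ℕ.* e ≟ n) _) ⟩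
    ∑ n (λ d → ∑ n λ b → term c e d b) ∎

⋆-assoc : ∀ f h k n → ((f ⋆ h) ⋆ k) n ≡ (f ⋆ (h ⋆ k)) n
⋆-assoc f h k n = trans (⋆-assoc-⋆₃ˡ f h k n) (sym (⋆-assoc-⋆₃ʳ f h k n))

⋆-inverse-unique : ∀ {f h h′} → IsDirichletInverse f h → IsDirichletInverse f h′ →
                   ∀ n → 1 ≤ n → h n ≡ h′ n
⋆-inverse-unique {f} {h} {h′} inv inv′ n 1≤n = begin
  h n                 ≡⟨ ⋆-identityʳ h n 1≤n ⟨
  (h ⋆ δ₁) n          ≡⟨ ⋆-congʳ n h (λ d 1≤d _ → sym (⋆-inverse inv′ d 1≤d)) ⟩
  (h ⋆ (f ⋆ h′)) n    ≡⟨ ⋆-assoc h f h′ n ⟨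
  ((h ⋆ f) ⋆ h′) n    ≡⟨ ⋆-congˡ n h′ (λ d 1≤d _ → trans (⋆-comm h f d) (⋆-inverse inv d 1≤d)) ⟩
  (δ₁ ⋆ h′) n         ≡⟨ ⋆-identityˡ h′ n 1≤n ⟩
  h′ n                ∎
  where
  open ≡-Reasoning
  ⋆-inverse : ∀ {h} → IsDirichletInverse f h → ∀ n → 1 ≤ n → (f ⋆ h) n ≡ δ₁ n
  ⋆-inverse {h} inv n 1≤n = trans (sym (dirichlet≡⋆ f h n)) (inv n 1≤n)

∑-nonNegative : ∀ n {f} → (∀ d → 1 ≤ d → d ≤ n → 0ℤ ℤ.≤ f d) → 0ℤ ℤ.≤ ∑ n f
∑-nonNegative zero _ = ℤₚ.≤-refl
∑-nonNegative (suc n) 0≤f =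
  ℤₚ.+-mono-≤ (∑-nonNegative n (λ d 1≤d d≤n → 0≤f d 1≤d (m≤n⇒m≤1+n d≤n))) (0≤f (suc n) (s≤s z≤n) ≤-refl)

-- The Möbius and Liouville functions

SquareFree : ℕ → Set
SquareFree n = ∀ q → Prime q → q ℕ.* q ∤ n

∈-range1 : ∀ {q n} → 1 ≤ q → q ≤ n → q ∈ range1 n
∈-range1 {suc _} _ q≤n = ∈-map⁺ suc (∈-upTo⁺ q≤n)

prime²∣⇒≤ : ∀ {q n} → 1 ≤ n → Prime q → q ℕ.* q ∣ n → q ≤ n
prime²∣⇒≤ {q} 1≤n q-prime q²∣n =
  ≤-trans (ℕₚ.m≤m*n q q {{prime⇒nonZero q-prime}}) (ℕᵈ.∣⇒≤ {{>-nonZero 1≤n}} q²∣n)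

squareFree? : ∀ n → 1 ≤ n → SquareFree n ⊎ ∃ λ q → Prime q × q ℕ.* q ∣ n
squareFree? n 1≤n with any? (λ q → prime? q ×-dec q ℕ.* q ∣? n) (range1 n)
... | yes square with find square
...   | q , _ , q-prime , q²∣n = inj₂ (q , q-prime , q²∣n)
squareFree? n 1≤n | no no-square = inj₁ λ q q-prime q²∣n →
  no-square (lose (∈-range1 (prime>0 q-prime) (prime²∣⇒≤ 1≤n q-prime q²∣n)) (q-prime , q²∣n))

μ-squareFree : ∀ {n} → SquareFree n → μ n ≡ (- 1ℤ) ℤ.^ ω n
μ-squareFree {n} sf =
  cong (λ ps → if null ps then (- 1ℤ) ℤ.^ ω n else 0ℤ)
       (filter-none (λ q → prime? q ×-dec q ℕ.* q ∣? n) {range1 n}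
                    (All.universal (λ q (q-prime , q²∣n) → sf q q-prime q²∣n) _))

μ-prime²∣ : ∀ {n q} → 1 ≤ n → Prime q → q ℕ.* q ∣ n → μ n ≡ 0ℤ
μ-prime²∣ {n} 1≤n q-prime q²∣n =
  null-nonempty (filter (λ q → prime? q ×-dec q ℕ.* q ∣? n) (range1 n))
    (filter-some (λ q → prime? q ×-dec q ℕ.* q ∣? n)
                 (lose (∈-range1 (prime>0 q-prime) (prime²∣⇒≤ 1≤n q-prime q²∣n)) (q-prime , q²∣n)))
  where
  null-nonempty : ∀ (ps : List ℕ) {x} → 0 < length ps → (if null ps then x else 0ℤ) ≡ 0ℤ
  null-nonempty (_ ∷ _) _ = refl

prime∤⇒coprime : ∀ {p d} → Prime p → p ∤ d → Coprime d p
prime∤⇒coprime p-prime p∤d (c∣d , c∣p) with prime⇒irreducible p-prime c∣p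
... | inj₁ c≡1 = c≡1
... | inj₂ refl = contradiction c∣d p∤d

prime∣p*d : ∀ {p q d} → Prime p → Prime q → q ∣ p ℕ.* d → q ≡ p ⊎ q ∣ d
prime∣p*d {d = d} p-prime q-prime q∣pd with euclidsLemma _ d q-prime q∣pd
... | inj₁ q∣p = inj₁ (prime∣prime⇒≡ p-prime q-prime q∣p)
... | inj₂ q∣d = inj₂ q∣d

squareFree-p* : ∀ {p d} → Prime p → p ∤ d → SquareFree d → SquareFree (p ℕ.* d)
squareFree-p* {p} {d} p-prime p∤d sf q q-prime q²∣pd
  with prime∣p*d p-prime q-prime (ℕᵈ.∣-trans (ℕᵈ.m∣m*n q) q²∣pd)
... | inj₁ refl = p∤d (ℕᵈ.*-cancelˡ-∣ p {{prime⇒nonZero p-prime}} q²∣pd)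
... | inj₂ (divides e refl) with prime∣p*d p-prime q-prime
      (ℕᵈ.*-cancelʳ-∣ q {{prime⇒nonZero q-prime}} (subst (q ℕ.* q ∣_) (sym (ℕₚ.*-assoc p e q)) q²∣pd))
...   | inj₁ refl = p∤d (ℕᵈ.n∣m*n e)
...   | inj₂ q∣e = sf q q-prime (ℕᵈ.*-monoˡ-∣ q q∣e)

ω-p* : ∀ {p d} → Prime p → 1 ≤ d → p ∤ d → ω (p ℕ.* d) ≡ ω d ℕ.+ 1
ω-p* {p} {d} p-prime 1≤d p∤d = begin
  ω (p ℕ.* d)
    ≡⟨ ω-∑ (p ℕ.* d) (ℕₚ.*-mono-≤ (prime>0 p-prime) 1≤d) ≤-refl ⟩
  ℕ+.∑ (p ℕ.* d) (λ q → 1 if prime? q ×-dec q ∣? p ℕ.* d else 0)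
    ≡⟨ ℕ+.∑-cong (p ℕ.* d) (λ q _ _ → split q) ⟩
  ℕ+.∑ (p ℕ.* d) (λ q → (1 if prime? q ×-dec q ∣? d else 0) ℕ.+ (1 if q ≟ p else 0))
    ≡⟨ ℕ+.∑-distrib (p ℕ.* d) _ _ ⟩
  ℕ+.∑ (p ℕ.* d) (λ q → 1 if prime? q ×-dec q ∣? d else 0)
    ℕ.+ ℕ+.∑ (p ℕ.* d) (λ q → 1 if q ≟ p else 0)
    ≡⟨ cong₂ ℕ._+_ (ω-∑ (p ℕ.* d) 1≤d (ℕₚ.m≤n*m d p {{prime⇒nonZero p-prime}}))
                   (sym (trans (ℕ+.∑-single (p ℕ.* d) p _ (prime>0 p-prime) (ℕₚ.m≤m*n p d {{>-nonZero 1≤d}})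
                                            (λ q _ _ → if-no (q ≟ p)))
                               (if-yes (p ≟ p) refl))) ⟨
  ω d ℕ.+ 1 ∎
  where
  open ≡-Reasoning
  split : ∀ q → (1 if prime? q ×-dec q ∣? p ℕ.* d else 0)
              ≡ (1 if prime? q ×-dec q ∣? d else 0) ℕ.+ (1 if q ≟ p else 0)
  split q rewrite if-×-dec (prime? q) (q ∣? p ℕ.* d) {1} {0} | if-×-dec (prime? q) (q ∣? d) {1} {0}
    with prime? q | q ≟ p
  ... | no ¬q-prime | yes refl = contradiction p-prime ¬q-prime
  ... | no _ | no _ = refl
  ... | yes _ | yes refl =
    trans (if-yes (p ∣? p ℕ.* d) (ℕᵈ.m∣m*n d)) (cong (ℕ._+ 1) (sym (if-no (p ∣? d) p∤d)))
  ... | yes q-prime | no q≢p = trans (if-⇔ (q ∣? p ℕ.* d) (q ∣? d) ∣pd⇒∣d (ℕᵈ.∣n⇒∣m*n p) refl)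
                                     (sym (ℕₚ.+-identityʳ _))
    where
    ∣pd⇒∣d : q ∣ p ℕ.* d → q ∣ d
    ∣pd⇒∣d q∣pd with prime∣p*d p-prime q-prime q∣pd
    ... | inj₁ q≡p = contradiction q≡p q≢p
    ... | inj₂ q∣d = q∣d

[-1]^k*[-1]^k≡1 : ∀ k → (- 1ℤ) ℤ.^ k * (- 1ℤ) ℤ.^ k ≡ 1ℤ
[-1]^k*[-1]^k≡1 zero = refl
[-1]^k*[-1]^k≡1 (suc k) = trans (square-neg ((- 1ℤ) ℤ.^ k)) ([-1]^k*[-1]^k≡1 k)
  where
  square-neg : ∀ s → (- 1ℤ * s) * (- 1ℤ * s) ≡ s * s
  square-neg = solve-∀

μ-p*-∣ : ∀ {p d} → Prime p → 1 ≤ d → p ∣ d → μ (p ℕ.* d) ≡ 0ℤ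
μ-p*-∣ {p} p-prime 1≤d p∣d = μ-prime²∣ (ℕₚ.*-mono-≤ (prime>0 p-prime) 1≤d) p-prime (ℕᵈ.*-monoʳ-∣ p p∣d)

μ-p*-∤ : ∀ {p d} → Prime p → 1 ≤ d → p ∤ d → μ (p ℕ.* d) ≡ - μ d
μ-p*-∤ {p} {d} p-prime 1≤d p∤d with squareFree? d 1≤d
... | inj₁ sf = begin
  μ (p ℕ.* d)                ≡⟨ μ-squareFree (squareFree-p* p-prime p∤d sf) ⟩
  (- 1ℤ) ℤ.^ ω (p ℕ.* d)       ≡⟨ cong ((- 1ℤ) ℤ.^_) (trans (ω-p* p-prime 1≤d p∤d) (ℕₚ.+-comm (ω d) 1)) ⟩
  - 1ℤ * (- 1ℤ) ℤ.^ ω d        ≡⟨ ℤₚ.-1*i≡-i _ ⟩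
  - ((- 1ℤ) ℤ.^ ω d)           ≡⟨ cong -_ (μ-squareFree sf) ⟨
  - μ d                      ∎
  where open ≡-Reasoning
... | inj₂ (q , q-prime , q²∣d) =
  trans (μ-prime²∣ (ℕₚ.*-mono-≤ (prime>0 p-prime) 1≤d) q-prime (ℕᵈ.∣n⇒∣m*n p q²∣d))
        (sym (cong -_ (μ-prime²∣ 1≤d q-prime q²∣d)))

liouville : ℕ → ℤ
liouville n = (- 1ℤ) ℤ.^ Ω n

liouville-* : ∀ {a b} → 1 ≤ a → 1 ≤ b → liouville (a ℕ.* b) ≡ liouville a * liouville b
liouville-* {a} {b} 1≤a 1≤b = trans (cong ((- 1ℤ) ℤ.^_) (Ω-* 1≤a 1≤b)) (ℤₚ.^-distribˡ-+-* (- 1ℤ) (Ω a) (Ω b))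

liouville-prime : ∀ {p} → Prime p → liouville p ≡ - 1ℤ
liouville-prime p-prime = cong ((- 1ℤ) ℤ.^_) (Ω-prime p-prime)

∣liouville∣≡1 : ∀ n → ∣ liouville n ∣ ≡ 1
∣liouville∣≡1 n = ∣[-1]^k∣≡1 (Ω n)
  where
  ∣[-1]^k∣≡1 : ∀ k → ∣ (- 1ℤ) ℤ.^ k ∣ ≡ 1
  ∣[-1]^k∣≡1 zero = refl
  ∣[-1]^k∣≡1 (suc k) = trans (ℤₚ.abs-* (- 1ℤ) ((- 1ℤ) ℤ.^ k)) (trans (ℕₚ.*-identityˡ _) (∣[-1]^k∣≡1 k))

Ω-squareFree : ∀ {d} → 1 ≤ d → SquareFree d → Ω d ≡ ω d
Ω-squareFree {d} 1≤d sf =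
  trans (Ω≡∑mult d) (trans (ℕ+.∑-cong d (λ q _ _ → mult≡1 q))
                           (sym (length-filter-range1 d (λ p → prime? p ×-dec p ∣? d))))
  where
  mult≡1 : ∀ q → (mult q d if prime? q ×-dec q ∣? d else 0) ≡ (1 if prime? q ×-dec q ∣? d else 0)
  mult≡1 q with prime? q ×-dec q ∣? d
  ... | yes (q-prime , q∣d) = mult-∣∤² (prime>1 q-prime) 1≤d q∣d (sf q q-prime)
  ... | no _ = refl

μ² : ℕ → ℤ
μ² n = μ n * μ n

μ≡liouville*μ² : ∀ {d} → 1 ≤ d → μ d ≡ liouville d * μ² d
μ≡liouville*μ² {d} 1≤d with squareFree? d 1≤d
... | inj₁ sf = begin
  μ d                                           ≡⟨ μ-squareFree sf ⟩
  (- 1ℤ) ℤ.^ ω d                                  ≡⟨ cong ((- 1ℤ) ℤ.^_) (Ω-squareFree 1≤d sf) ⟨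
  liouville d                                   ≡⟨ ℤₚ.*-identityʳ (liouville d) ⟨
  liouville d * 1ℤ                              ≡⟨ cong (liouville d *_) ([-1]^k*[-1]^k≡1 (ω d)) ⟨
  liouville d * ((- 1ℤ) ℤ.^ ω d * (- 1ℤ) ℤ.^ ω d)   ≡⟨ cong (λ s → liouville d * (s * s)) (μ-squareFree sf) ⟨
  liouville d * μ² d                            ∎
  where open ≡-Reasoning
... | inj₂ (q , q-prime , q²∣d) rewrite μ-prime²∣ 1≤d q-prime q²∣d = sym (ℤₚ.*-zeroʳ (liouville d))

0≤μ² : ∀ {d} → 1 ≤ d → 0ℤ ℤ.≤ μ² d
0≤μ² {d} 1≤d with squareFree? d 1≤d
... | inj₁ sf rewrite μ-squareFree sf | [-1]^k*[-1]^k≡1 (ω d) = ℤ.+≤+ z≤n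
... | inj₂ (q , q-prime , q²∣d) rewrite μ-prime²∣ 1≤d q-prime q²∣d = ℤ.+≤+ z≤n

divisorSum-multiples : ∀ {n m p} (F : ℕ → ℤ) → 1 ≤ n → 1 ≤ p → n ≡ p ℕ.* m →
  divisorSum n (λ d → F d if p ∣? d else 0ℤ) ≡ divisorSum m (λ k → F (p ℕ.* k))
divisorSum-multiples {n} {m} {p} F 1≤n 1≤p n≡pm = sym (begin
  ∑ m (λ k → F (p ℕ.* k) if k ∣? m else 0ℤ)
    ≡⟨ ∑-cong m (λ k 1≤k _ → sym (trans (∑-select n (p ℕ.* k) (_∣? n) _ (ℕₚ.*-mono-≤ 1≤p 1≤k)
                                                   (ℕᵈ.>⇒∤ {{>-nonZero 1≤n}}))
                                        (if-⇔ (p ℕ.* k ∣? n) (k ∣? m) pk∣n⇒k∣m k∣m⇒pk∣n refl))) ⟩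
  ∑ m (λ k → ∑ n λ d → ((F (p ℕ.* k) if p ℕ.* k ≟ d else 0ℤ) if d ∣? n else 0ℤ))
    ≡⟨ ∑-comm m n _ ⟩
  ∑ n (λ d → ∑ m λ k → ((F (p ℕ.* k) if p ℕ.* k ≟ d else 0ℤ) if d ∣? n else 0ℤ))
    ≡⟨ ∑-cong n (λ d 1≤d d≤n → trans (sym (∑-if m (d ∣? n) _))
                                      (cong (_if d ∣? n else 0ℤ) (multiple d 1≤d d≤n))) ⟩
  ∑ n (λ d → (F d if p ∣? d else 0ℤ) if d ∣? n else 0ℤ) ∎)
  where
  open ≡-Reasoning
  instance _ = >-nonZero 1≤p
  pk∣n⇒k∣m : ∀ {k} → p ℕ.* k ∣ n → k ∣ m
  pk∣n⇒k∣m pk∣n = ℕᵈ.*-cancelˡ-∣ p (subst (p ℕ.* _ ∣_) n≡pm pk∣n)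
  k∣m⇒pk∣n : ∀ {k} → k ∣ m → p ℕ.* k ∣ n
  k∣m⇒pk∣n k∣m = subst (p ℕ.* _ ∣_) (sym n≡pm) (ℕᵈ.*-monoʳ-∣ p k∣m)
  multiple : ∀ d → 1 ≤ d → d ≤ n →
             ∑ m (λ k → F (p ℕ.* k) if p ℕ.* k ≟ d else 0ℤ) ≡ (F d if p ∣? d else 0ℤ)
  multiple d 1≤d d≤n with p ∣? d
  ... | no p∤d = ∑-ε m _ (λ k _ _ → if-no (p ℕ.* k ≟ d)
                                          (λ pk≡d → p∤d (divides k (trans (sym pk≡d) (ℕₚ.*-comm p k)))))
  ... | yes (divides k d≡kp) =
    trans (∑-single m k _ 1≤k k≤m (λ k′ _ _ k′≢k → if-no (p ℕ.* k′ ≟ d) (k′≢k ∘ cancel)))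
          (trans (if-yes (p ℕ.* k ≟ d) pk≡d) (cong F pk≡d))
    where
    pk≡d = trans (ℕₚ.*-comm p k) (sym d≡kp)
    1≤k = *-positiveˡ k (subst (1 ≤_) d≡kp 1≤d)
    k≤m = ℕₚ.*-cancelˡ-≤ p (subst (p ℕ.* k ≤_) n≡pm (subst (_≤ n) (sym pk≡d) d≤n))
    cancel : ∀ {k′} → p ℕ.* k′ ≡ d → k′ ≡ k
    cancel pk′≡d = ℕₚ.*-cancelˡ-≡ _ k p (trans pk′≡d (sym pk≡d))

divisorSum-coprime : ∀ {n m p} (F : ℕ → ℤ) → Prime p → 1 ≤ m → n ≡ p ℕ.* m →
  divisorSum n (λ d → F d if ¬? (p ∣? d) else 0ℤ) ≡ divisorSum m (λ d → F d if ¬? (p ∣? d) else 0ℤ)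
divisorSum-coprime {n} {m} {p} F p-prime 1≤m n≡pm =
  trans (∑-cong n (λ d _ _ → same-divisors d))
        (∑-extend m n _ m≤n (λ d m<d _ → if-no (d ∣? m) (ℕᵈ.>⇒∤ {{>-nonZero 1≤m}} m<d)))
  where
  m≤n = subst (m ≤_) (sym n≡pm) (ℕₚ.m≤n*m m p {{prime⇒nonZero p-prime}})
  same-divisors : ∀ d → ((F d if ¬? (p ∣? d) else 0ℤ) if d ∣? n else 0ℤ)
                      ≡ ((F d if ¬? (p ∣? d) else 0ℤ) if d ∣? m else 0ℤ)
  same-divisors d with p ∣? d
  ... | yes _ = trans (if-same (d ∣? n)) (sym (if-same (d ∣? m)))
  ... | no p∤d = if-⇔ (d ∣? n) (d ∣? m)
                      (λ d∣n → coprime-divisor (prime∤⇒coprime p-prime p∤d) (subst (d ∣_) n≡pm d∣n))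
                      (λ d∣m → ℕᵈ.∣-trans d∣m (divides p n≡pm)) refl

divisorSum-neg : ∀ m G → divisorSum m (λ d → - G d) ≡ - divisorSum m G
divisorSum-neg m G =
  sym (trans (∑-homomorphic -_ refl ℤₚ.neg-distrib-+ m _) (∑-cong m (λ d _ _ → if-map -_ (d ∣? m))))

𝟙 : ℕ → ℤ
𝟙 _ = 1ℤ

μ⋆𝟙 : ∀ n → 1 ≤ n → (μ ⋆ 𝟙) n ≡ δ₁ n
μ⋆𝟙 (suc zero) _ = refl
μ⋆𝟙 n@(suc (suc _)) 1≤n with ∃-prime-divisor n (s≤s (s≤s z≤n))
... | p , p-prime , p∣n = begin
  (μ ⋆ 𝟙) n
    ≡⟨ ⋆-divisorSum μ 𝟙 n ⟩
  divisorSum n (λ d → μ d * 1ℤ)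
    ≡⟨ trans (∑-cong n (λ d _ _ → split d)) (∑-distrib n _ _) ⟩
  divisorSum n (λ d → μ d if p ∣? d else 0ℤ) + divisorSum n (λ d → μ d if ¬? (p ∣? d) else 0ℤ)
    ≡⟨ cong₂ _+_ (divisorSum-multiples μ 1≤n (prime>0 p-prime) n≡pm)
                 (divisorSum-coprime μ p-prime 1≤m n≡pm) ⟩
  divisorSum m (λ k → μ (p ℕ.* k)) + divisorSum m μ∤
    ≡⟨ cong (_+ divisorSum m μ∤) (trans (∑-cong m (λ k 1≤k _ → cong (_if k ∣? m else 0ℤ) (μ-p* k 1≤k)))
                                        (divisorSum-neg m μ∤)) ⟩
  - divisorSum m μ∤ + divisorSum m μ∤
    ≡⟨ ℤₚ.+-inverseˡ (divisorSum m μ∤) ⟩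
  0ℤ ∎
  where
  open ≡-Reasoning
  m = n ÷ p
  n≡pm = n≡d*[n÷d] (prime>0 p-prime) p∣n
  1≤m = ÷-positive 1≤n (prime>0 p-prime) p∣n
  μ∤ : ℕ → ℤ
  μ∤ d = μ d if ¬? (p ∣? d) else 0ℤ
  split : ∀ d → (μ d * 1ℤ if d ∣? n else 0ℤ)
              ≡ ((μ d if p ∣? d else 0ℤ) if d ∣? n else 0ℤ) + (μ∤ d if d ∣? n else 0ℤ)
  split d with d ∣? n | p ∣? d
  ... | no _ | _ = refl
  ... | yes _ | yes _ = trans (ℤₚ.*-identityʳ (μ d)) (sym (ℤₚ.+-identityʳ (μ d)))
  ... | yes _ | no _ = trans (ℤₚ.*-identityʳ (μ d)) (sym (ℤₚ.+-identityˡ (μ d)))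
  μ-p* : ∀ k → 1 ≤ k → μ (p ℕ.* k) ≡ - μ∤ k
  μ-p* k 1≤k with p ∣? k
  ... | yes p∣k = μ-p*-∣ p-prime 1≤k p∣k
  ... | no p∤k = μ-p*-∤ p-prime 1≤k p∤k

-- The inverse of g

𝟙ℙ : ℕ → ℤ
𝟙ℙ d = 1ℤ if prime? d else 0ℤ

δ₁+𝟙ℙ : ℕ → ℤ
δ₁+𝟙ℙ d = δ₁ d + 𝟙ℙ d

+-∑ : ∀ n f → + ℕ+.∑ n f ≡ ∑ n (λ d → + f d)
+-∑ zero f = refl
+-∑ (suc n) f = trans (ℤₚ.pos-+ (ℕ+.∑ n f) (f (suc n))) (cong (_+ + f (suc n)) (+-∑ n f))

g≡𝟙⋆[δ₁+𝟙ℙ] : ∀ n → 1 ≤ n → g n ≡ (𝟙 ⋆ δ₁+𝟙ℙ) n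
g≡𝟙⋆[δ₁+𝟙ℙ] n 1≤n = sym (begin
  (𝟙 ⋆ δ₁+𝟙ℙ) n                                    ≡⟨ ⋆-comm 𝟙 δ₁+𝟙ℙ n ⟩
  (δ₁+𝟙ℙ ⋆ 𝟙) n                                    ≡⟨ ⋆-divisorSum δ₁+𝟙ℙ 𝟙 n ⟩
  divisorSum n (λ d → δ₁+𝟙ℙ d * 1ℤ)                ≡⟨ trans (∑-cong n (λ d _ _ → split d)) (∑-distrib n _ _) ⟩
  divisorSum n (λ d → δ₁ d * 1ℤ) + divisorSum n 𝟙ℙ  ≡⟨ cong₂ _+_ (divisorSum-δ₁ n 𝟙 1≤n) divisorSum-𝟙ℙ ⟩
  1ℤ + + ω n                                       ≡⟨ ℤₚ.+-comm 1ℤ (+ ω n) ⟩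
  + ω n + 1ℤ                                       ≡⟨ ℤₚ.pos-+ (ω n) 1 ⟨
  g n                                              ∎)
  where
  open ≡-Reasoning
  split : ∀ d → (δ₁+𝟙ℙ d * 1ℤ if d ∣? n else 0ℤ)
              ≡ (δ₁ d * 1ℤ if d ∣? n else 0ℤ) + (𝟙ℙ d if d ∣? n else 0ℤ)
  split d = trans (cong (_if d ∣? n else 0ℤ) (trans (ℤₚ.*-distribʳ-+ 1ℤ (δ₁ d) (𝟙ℙ d))
                                                    (cong (λ x → δ₁ d * 1ℤ + x) (ℤₚ.*-identityʳ (𝟙ℙ d)))))
                  (if-∙ (d ∣? n) _ _)
  prime-divisor : ∀ d → + (1 if prime? d ×-dec d ∣? n else 0) ≡ (𝟙ℙ d if d ∣? n else 0ℤ)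
  prime-divisor d with prime? d | d ∣? n
  ... | yes _ | yes _ = refl
  ... | yes _ | no _ = refl
  ... | no _ | yes _ = refl
  ... | no _ | no _ = refl
  divisorSum-𝟙ℙ : divisorSum n 𝟙ℙ ≡ + ω n
  divisorSum-𝟙ℙ = sym (trans (cong +_ (ω-∑ n 1≤n ≤-refl))
                             (trans (+-∑ n _) (∑-cong n (λ d _ _ → prime-divisor d))))

liouville-÷ : ∀ {n p} → 1 ≤ n → Prime p → p ∣ n → liouville (n ÷ p) ≡ - liouville n
liouville-÷ {n} {p} 1≤n p-prime p∣n = sym (begin
  - liouville n                  ≡⟨ cong (-_ ∘ liouville) (n≡d*[n÷d] (prime>0 p-prime) p∣n) ⟩
  - liouville (p ℕ.* m)          ≡⟨ cong -_ (liouville-* (prime>0 p-prime) 1≤m) ⟩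
  - (liouville p * liouville m)  ≡⟨ cong (λ s → - (s * liouville m)) (liouville-prime p-prime) ⟩
  - (- 1ℤ * liouville m)         ≡⟨ cong -_ (ℤₚ.-1*i≡-i (liouville m)) ⟩
  - - liouville m                ≡⟨ ℤₚ.neg-involutive (liouville m) ⟩
  liouville m                    ∎)
  where
  open ≡-Reasoning
  m = n ÷ p
  1≤m = ÷-positive 1≤n (prime>0 p-prime) p∣n

liouvilleCΩ : ℕ → ℤ
liouvilleCΩ d = liouville d * + CΩ d

-- the recurrence CΩ(n) = Σ_{p ∣ n} CΩ(n/p), with the sign λ(n/p) = -λ(n)
𝟙ℙ⋆liouvilleCΩ : ∀ n → 1 < n → (𝟙ℙ ⋆ liouvilleCΩ) n ≡ - liouville n * + CΩ n
𝟙ℙ⋆liouvilleCΩ n 1<n = begin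
  (𝟙ℙ ⋆ liouvilleCΩ) n
    ≡⟨ ⋆-divisorSum 𝟙ℙ liouvilleCΩ n ⟩
  divisorSum n (λ q → 𝟙ℙ q * liouvilleCΩ (n ÷ q))
    ≡⟨ ∑-cong n (λ q _ _ → term q) ⟩
  ∑ n (λ q → - liouville n * + (CΩ (n ÷ q) if prime? q ×-dec q ∣? n else 0))
    ≡⟨ *-∑ n (- liouville n) _ ⟨
  - liouville n * ∑ n (λ q → + (CΩ (n ÷ q) if prime? q ×-dec q ∣? n else 0))
    ≡⟨ cong (- liouville n *_) (+-∑ n _) ⟨
  - liouville n * + primeCofactorSum CΩ n
    ≡⟨ cong (λ c → - liouville n * + c) (CΩ-recurrence 1<n) ⟨
  - liouville n * + CΩ n ∎
  where
  open ≡-Reasoning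
  1≤n = ≤-trans (s≤s z≤n) 1<n
  term : ∀ q → (𝟙ℙ q * liouvilleCΩ (n ÷ q) if q ∣? n else 0ℤ)
             ≡ - liouville n * + (CΩ (n ÷ q) if prime? q ×-dec q ∣? n else 0)
  term q with prime? q | q ∣? n
  ... | yes q-prime | yes q∣n =
    trans (ℤₚ.*-identityˡ _) (cong (_* + CΩ (n ÷ q)) (liouville-÷ 1≤n q-prime q∣n))
  ... | yes _ | no _ = sym (ℤₚ.*-zeroʳ (- liouville n))
  ... | no _ | yes _ = sym (ℤₚ.*-zeroʳ (- liouville n))
  ... | no _ | no _ = sym (ℤₚ.*-zeroʳ (- liouville n))

[δ₁+𝟙ℙ]⋆liouvilleCΩ : ∀ n → 1 ≤ n → (δ₁+𝟙ℙ ⋆ liouvilleCΩ) n ≡ δ₁ n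
[δ₁+𝟙ℙ]⋆liouvilleCΩ n 1≤n =
  trans (⋆-distribʳ-+ δ₁ 𝟙ℙ liouvilleCΩ n)
        (trans (cong (_+ (𝟙ℙ ⋆ liouvilleCΩ) n) (⋆-identityˡ liouvilleCΩ n 1≤n)) (cancel n 1≤n))
  where
  cancel : ∀ n → 1 ≤ n → liouvilleCΩ n + (𝟙ℙ ⋆ liouvilleCΩ) n ≡ δ₁ n
  cancel (suc zero) _ = refl
  cancel n@(suc (suc _)) _ = trans (cong (λ x → liouvilleCΩ n + x) (𝟙ℙ⋆liouvilleCΩ n (s≤s (s≤s z≤n))))
                                   (a*b+-a*b≡0 (liouville n) (+ CΩ n))
    where
    a*b+-a*b≡0 : ∀ a b → a * b + - a * b ≡ 0ℤ
    a*b+-a*b≡0 = solve-∀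

δ₁+𝟙ℙ⋆[μ⋆liouvilleCΩ] : ∀ n → 1 ≤ n → (δ₁+𝟙ℙ ⋆ (μ ⋆ liouvilleCΩ)) n ≡ μ n
δ₁+𝟙ℙ⋆[μ⋆liouvilleCΩ] n 1≤n = begin
  (δ₁+𝟙ℙ ⋆ (μ ⋆ liouvilleCΩ)) n   ≡⟨ ⋆-congʳ n δ₁+𝟙ℙ (λ d _ _ → ⋆-comm μ liouvilleCΩ d) ⟩
  (δ₁+𝟙ℙ ⋆ (liouvilleCΩ ⋆ μ)) n   ≡⟨ ⋆-assoc δ₁+𝟙ℙ liouvilleCΩ μ n ⟨
  ((δ₁+𝟙ℙ ⋆ liouvilleCΩ) ⋆ μ) n   ≡⟨ ⋆-congˡ n μ (λ d 1≤d _ → [δ₁+𝟙ℙ]⋆liouvilleCΩ d 1≤d) ⟩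
  (δ₁ ⋆ μ) n                      ≡⟨ ⋆-identityˡ μ n 1≤n ⟩
  μ n                             ∎
  where open ≡-Reasoning

g⋆[μ⋆liouvilleCΩ] : ∀ n → 1 ≤ n → (g ⋆ (μ ⋆ liouvilleCΩ)) n ≡ δ₁ n
g⋆[μ⋆liouvilleCΩ] n 1≤n = begin
  (g ⋆ (μ ⋆ liouvilleCΩ)) n              ≡⟨ ⋆-congˡ n (μ ⋆ liouvilleCΩ) (λ d 1≤d _ → g≡𝟙⋆[δ₁+𝟙ℙ] d 1≤d) ⟩
  ((𝟙 ⋆ δ₁+𝟙ℙ) ⋆ (μ ⋆ liouvilleCΩ)) n    ≡⟨ ⋆-assoc 𝟙 δ₁+𝟙ℙ (μ ⋆ liouvilleCΩ) n ⟩
  (𝟙 ⋆ (δ₁+𝟙ℙ ⋆ (μ ⋆ liouvilleCΩ))) n    ≡⟨ ⋆-congʳ n 𝟙 (λ d 1≤d _ → δ₁+𝟙ℙ⋆[μ⋆liouvilleCΩ] d 1≤d) ⟩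
  (𝟙 ⋆ μ) n                              ≡⟨ ⋆-comm 𝟙 μ n ⟩
  (μ ⋆ 𝟙) n                              ≡⟨ μ⋆𝟙 n 1≤n ⟩
  δ₁ n                                   ∎
  where open ≡-Reasoning

μ⋆liouvilleCΩ : ∀ n → 1 ≤ n →
                (μ ⋆ liouvilleCΩ) n ≡ liouville n * divisorSum n (λ d → μ² d * + CΩ (n ÷ d))
μ⋆liouvilleCΩ n 1≤n =
  trans (⋆-divisorSum μ liouvilleCΩ n)
        (trans (∑-cong n (λ d 1≤d _ → term d 1≤d)) (sym (*-∑ n (liouville n) _)))
  where
  open ≡-Reasoning
  term : ∀ d → 1 ≤ d → (μ d * liouvilleCΩ (n ÷ d) if d ∣? n else 0ℤ)
                     ≡ liouville n * (μ² d * + CΩ (n ÷ d) if d ∣? n else 0ℤ)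
  term d 1≤d with d ∣? n
  ... | no _ = sym (ℤₚ.*-zeroʳ (liouville n))
  ... | yes d∣n = begin
    μ d * (liouville m * + CΩ m)
      ≡⟨ cong (_* (liouville m * + CΩ m)) (μ≡liouville*μ² 1≤d) ⟩
    liouville d * μ² d * (liouville m * + CΩ m)
      ≡⟨ ℤ*-Props.interchange (liouville d) (μ² d) (liouville m) (+ CΩ m) ⟩
    liouville d * liouville m * (μ² d * + CΩ m)
      ≡⟨ cong (_* (μ² d * + CΩ m)) (liouville-* 1≤d (÷-positive 1≤n 1≤d d∣n)) ⟨
    liouville (d ℕ.* m) * (μ² d * + CΩ m)
      ≡⟨ cong (λ k → liouville k * (μ² d * + CΩ m)) (n≡d*[n÷d] 1≤d d∣n) ⟨
    liouville n * (μ² d * + CΩ m) ∎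
    where
    m = n ÷ d

0≤divisorSum-μ²CΩ : ∀ n → 0ℤ ℤ.≤ divisorSum n (λ d → μ² d * + CΩ (n ÷ d))
0≤divisorSum-μ²CΩ n = ∑-nonNegative n (λ d 1≤d _ → term d 1≤d)
  where
  term : ∀ d → 1 ≤ d → 0ℤ ℤ.≤ (μ² d * + CΩ (n ÷ d) if d ∣? n else 0ℤ)
  term d 1≤d with d ∣? n
  ... | yes _ = ℤₚ.*-monoʳ-≤-nonNeg (+ CΩ (n ÷ d)) (0≤μ² 1≤d)
  ... | no _ = ℤₚ.≤-refl

g-inverse : IsDirichletInverse g (μ ⋆ liouvilleCΩ)
g-inverse n 1≤n = trans (dirichlet≡⋆ g (μ ⋆ liouvilleCΩ) n) (g⋆[μ⋆liouvilleCΩ] n 1≤n)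

+∣μ⋆liouvilleCΩ∣ : ∀ n → 1 ≤ n →
                   + ∣ (μ ⋆ liouvilleCΩ) n ∣ ≡ divisorSum n (λ d → μ² d * + CΩ (n ÷ d))
+∣μ⋆liouvilleCΩ∣ n 1≤n = begin
  + ∣ (μ ⋆ liouvilleCΩ) n ∣       ≡⟨ cong (+_ ∘ ∣_∣) (μ⋆liouvilleCΩ n 1≤n) ⟩
  + ∣ liouville n * S ∣           ≡⟨ cong +_ (ℤₚ.abs-* (liouville n) S) ⟩
  + (∣ liouville n ∣ ℕ.* ∣ S ∣)   ≡⟨ cong (λ k → + (k ℕ.* ∣ S ∣)) (∣liouville∣≡1 n) ⟩
  + (1 ℕ.* ∣ S ∣)                 ≡⟨ cong +_ (ℕₚ.*-identityˡ ∣ S ∣) ⟩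
  + ∣ S ∣                         ≡⟨ ℤₚ.0≤i⇒+∣i∣≡i (0≤divisorSum-μ²CΩ n) ⟩
  S                               ∎
  where
  open ≡-Reasoning
  S = divisorSum n (λ d → μ² d * + CΩ (n ÷ d))

divisorSum-μ²CΩ≡sumℤ : ∀ n →
  divisorSum n (λ d → μ² d * + CΩ (n ÷ d))
    ≡ sumℤ (map (λ i → μ² (n / suc i) * + CΩ (suc i)) (filter (λ i → suc i ∣? n) (upTo n)))
divisorSum-μ²CΩ≡sumℤ n = begin
  divisorSum n (λ d → μ² d * + CΩ (n ÷ d))   ≡⟨ ⋆-divisorSum μ² (+_ ∘ CΩ) n ⟨
  (μ² ⋆ (+_ ∘ CΩ)) n                         ≡⟨ ⋆-comm μ² (+_ ∘ CΩ) n ⟩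
  ((+_ ∘ CΩ) ⋆ μ²) n                         ≡⟨ ⋆-divisorSum (+_ ∘ CΩ) μ² n ⟩
  divisorSum n (λ d → + CΩ d * μ² (n ÷ d))
    ≡⟨ ∑-cong n (λ d _ _ → cong (_if d ∣? n else 0ℤ) (ℤₚ.*-comm (+ CΩ d) _)) ⟩
  divisorSum n (λ d → μ² (n ÷ d) * + CΩ d)   ≡⟨ sumℤ-divisors n (λ d → μ² (n ÷ d) * + CΩ d) ⟨
  sumℤ (map (λ i → μ² (n / suc i) * + CΩ (suc i)) (filter (λ i → suc i ∣? n) (upTo n))) ∎
  where open ≡-Reasoning

corollary3p3 : (ginv : ℕ → ℤ) → IsDirichletInverse g ginv →
    ∀ n → 1 ≤ n →
      + ∣ ginv n ∣ ≡
        sumℤ (map (λ i → (μ (n / suc i) * μ (n / suc i)) * + CΩ (suc i))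
                  (filter (λ i → suc i ∣? n) (upTo n)))
corollary3p3 ginv inv n 1≤n = begin
  + ∣ ginv n ∣                               ≡⟨ cong (+_ ∘ ∣_∣) ginv≡μ⋆liouvilleCΩ ⟩
  + ∣ (μ ⋆ liouvilleCΩ) n ∣                   ≡⟨ +∣μ⋆liouvilleCΩ∣ n 1≤n ⟩
  divisorSum n (λ d → μ² d * + CΩ (n ÷ d))   ≡⟨ divisorSum-μ²CΩ≡sumℤ n ⟩
  sumℤ (map (λ i → μ² (n / suc i) * + CΩ (suc i)) (filter (λ i → suc i ∣? n) (upTo n))) ∎
  where
  open ≡-Reasoning
  ginv≡μ⋆liouvilleCΩ : ginv n ≡ (μ ⋆ liouvilleCΩ) n
  ginv≡μ⋆liouvilleCΩ = ⋆-inverse-unique {g} {ginv} {μ ⋆ liouvilleCΩ} inv g-inverse n 1≤n
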